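{- Let $\mathbb{F}$ be a field and $\Gamma$ a finite group such that either $\mathrm{char}(\mathbb{F})=0$, or $\mathrm{char}(\mathbb{F})>0$ and $|\Gamma|$ and $\mathrm{char}(\mathbb{F})$ are coprime. Let $k\in\mathbb{N}$ be a constant. Then there is a constant $c$ depending only on $k$ such that for every finite set of variables $X$ on which $\Gamma$ acts and every $\Gamma$-invariant system of polynomial equations $\mathcal{F}\subseteq\mathbb{F}[X]$ that possesses an IPS refutation $C$ of semantic degree at most $k$, there exists a $\Gamma$-symmetric IPS refutation $C^{sym}$ of $\mathcal{F}$ with $|C^{sym}|\le c\,|\mathcal{F}|^{k}\le c\,|C|^{k}$. Moreover, if $C$ is $\vec y$-linear, then so is $C^{sym}$.
   Context: A system of polynomial equations is a finite set $\mathcal{F}=\{f_1,\dots,f_m\}\subseteq\mathbb{F}[X]$; its size is $|\mathcal{F}|:=m+|X|$. A group acting on $X$ acts on polynomials by substitution; $\mathcal{F}$ is $\Gamma$-invariant if $\{\pi(f):f\in\mathcal{F}\}=\mathcal{F}$ for all $\pi\in\Gamma$. An algebraic circuit over a variable set $Z$ and field $\mathbb{F}$ is a connected directed acyclic graph whose in-degree-$0$ gates are labelled by elements of $Z\cup\mathbb{F}$ and whose other gates are labelled $+$ or $\times$ (arbitrary fan-in), with a single output gate, computing a polynomial in the obvious way. Its semantic degree is the maximum degree of a polynomial computed at any of its gates. If $\Gamma$ acts on $Z$ (trivially on $\mathbb{F}$), the circuit is $\Gamma$-symmetric if every $\pi\in\Gamma$ extends to an automorphism $\sigma$ of the directed graph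 preserving labels of internal gates and satisfying $\lambda(\sigma(g))=\pi(\lambda(g))$ for input gates $g$. IPS: with fresh variables $Y=\{y_1,\dots,y_m\}$, an IPS certificate is $C(\vec x,\vec y)\in\mathbb{F}[X\uplus Y]$ with $C(\vec x,\vec 0)=0$ and $C(\vec x,f_1,\dots,f_m)=1$; an IPS refutation is an algebraic circuit over $X\uplus Y$ computing one. The size of a refutation with gate set $D$ is $|C|:=\max(|D|,|X|+|Y|)$. It is $\vec y$-linear if the certificate has the form $\sum_{i=1}^m y_i g_i(\vec x)$. For $\Gamma$-invariant $\mathcal{F}$, $\Gamma$ acts on $Y$ by $\pi(y_i)=y_j$ where $\pi(f_i)=f_j$; a $\Gamma$-symmetric IPS refutation is an IPS refutation that is a $\Gamma$-symmetric circuit w.r.t. this action on $X\uplus Y$. -}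

module Defs where

open import Level using (Level; _⊔_; Lift) renaming (suc to lsuc)
open import Data.Nat as ℕ using (ℕ; zero; suc; _<_; _≤_; _^_)
import Data.Nat.Properties as ℕP
open import Data.Nat.Coprimality using (Coprime)
open import Data.Fin as Fin using (Fin; zero; suc; splitAt; _↑ˡ_; _↑ʳ_)
open import Data.Vec as Vec using (Vec; []; _∷_; lookup)
import Data.Vec.Properties as VecP
open import Data.List as List using (List; []; _∷_; allFin)
open import Data.List.Membership.Propositional using (_∈_)
open import Data.List.Relation.Unary.Unique.Propositional using (Unique)
open import Data.Product using (Σ; ∃; _×_; _,_)
open import Data.Sum using (_⊎_; inj₁; inj₂; [_,_]′)
open import Relation.Nullary using (¬_; yes; no)
open import Relation.Binary.PropositionalEquality using (_≡_)
open import Algebra.Bundles using (CommutativeRing; Group)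

record Field (a ℓ : Level) : Set (lsuc (a ⊔ ℓ)) where
  field
    commutativeRing : CommutativeRing a ℓ
  open CommutativeRing commutativeRing public
  field
    1≉0     : ¬ (1# ≈ 0#)
    inverse : ∀ x → ¬ (x ≈ 0#) → Σ Carrier λ y → x * y ≈ 1#

IsFiniteOfOrder : ∀ {g gℓ} → Group g gℓ → ℕ → Set (g ⊔ gℓ)
IsFiniteOfOrder Γ o =
  Σ (Fin o → Carrier) λ enum →
    (∀ x → Σ (Fin o) λ i → enum i ≈ x) ×
    (∀ i j → enum i ≈ enum j → i ≡ j)
  where open Group Γ

record Action {g gℓ} (Γ : Group g gℓ) (nX : ℕ) : Set (g ⊔ gℓ) where
  open Group Γ
  field
    act      : Carrier → Fin nX → Fin nX
    act-cong : ∀ {π ρ} → π ≈ ρ → ∀ x → act π x ≡ act ρ x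
    act-id   : ∀ x → act ε x ≡ x
    act-comp : ∀ π ρ x → act (π ∙ ρ) x ≡ act π (act ρ x)

module _ {a ℓ : Level} (F : Field a ℓ) where
  open Field F using (Carrier; _≈_; _+_; _*_; 0#; 1#)

  _×1 : ℕ → Carrier
  zero ×1 = 0#
  suc n ×1 = 1# + (n ×1)

  CharZero : Set ℓ
  CharZero = ∀ n → ¬ ((suc n) ×1 ≈ 0#)

  HasChar : ℕ → Set ℓ
  HasChar p = (0 < p) × (p ×1 ≈ 0#) × (∀ n → 0 < n → n < p → ¬ (n ×1 ≈ 0#))

  CharCondition : ℕ → Set ℓ
  CharCondition o = CharZero ⊎ Σ ℕ λ p → HasChar p × Coprime p o

  -- Polynomials in F[x_0,…,x_{n-1}]: finite lists of terms c·x^e,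
  -- with equality "same coefficient at every monomial".

  record Term (n : ℕ) : Set a where
    constructor term
    field
      coef : Carrier
      expo : Vec ℕ n

  Poly : ℕ → Set a
  Poly n = List (Term n)

  coeff : ∀ {n} → Poly n → Vec ℕ n → Carrier
  coeff [] e = 0#
  coeff (term c e′ ∷ p) e with VecP.≡-dec ℕP._≟_ e′ e
  ... | yes _ = c + coeff p e
  ... | no  _ = coeff p e

  infix 4 _≈P_
  _≈P_ : ∀ {n} → Poly n → Poly n → Set ℓ
  p ≈P q = ∀ e → coeff p e ≈ coeff q e

  constP : ∀ {n} → Carrier → Poly n
  constP c = term c (Vec.replicate _ 0) ∷ []

  0P 1P : ∀ {n} → Poly n
  0P = []
  1P = constP 1#

  unitVec : ∀ {n} → Fin n → Vec ℕ n
  unitVec zero    = 1 ∷ Vec.replicate _ 0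
  unitVec (suc i) = 0 ∷ unitVec i

  varP : ∀ {n} → Fin n → Poly n
  varP i = term 1# (unitVec i) ∷ []

  _+P_ : ∀ {n} → Poly n → Poly n → Poly n
  p +P q = p List.++ q

  _*P_ : ∀ {n} → Poly n → Poly n → Poly n
  p *P q = List.concatMap
    (λ t → List.map (λ s → term (Term.coef t * Term.coef s)
                                 (Vec.zipWith ℕ._+_ (Term.expo t) (Term.expo s))) q) p

  sumP prodP : ∀ {n} → List (Poly n) → Poly n
  sumP  = List.foldr _+P_ 0P
  prodP = List.foldr _*P_ 1P

  powP : ∀ {n} → Poly n → ℕ → Poly n
  powP p zero    = 1P
  powP p (suc k) = p *P powP p k

  monoSubst : ∀ {n k} → Vec ℕ n → (Fin n → Poly k) → Poly k
  monoSubst []       σ = 1P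
  monoSubst (e ∷ es) σ = powP (σ zero) e *P monoSubst es (λ i → σ (suc i))

  substP : ∀ {n k} → Poly n → (Fin n → Poly k) → Poly k
  substP p σ = sumP (List.map (λ t → constP (Term.coef t) *P monoSubst (Term.expo t) σ) p)

  DegreeAtMost : ∀ {n} → ℕ → Poly n → Set ℓ
  DegreeAtMost k p = ∀ e → k < Vec.sum e → coeff p e ≈ 0#

  -- Gates are added one at a time; a new gate may only take previously
  -- built gates as children (so the graph is acyclic). In a circuit with
  -- n gates, gate `zero` is the last one built (the output gate) and the
  -- children of gate i all have larger index.

  data OpLabel : Set where
    plus times : OpLabel

  data GateDef (nZ m : ℕ) : Set a where
    inVar   : Fin nZ → GateDef nZ m
    inConst : Carrier → GateDef nZ m
    op      : OpLabel → List (Fin m) → GateDef nZ m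

  infixl 5 _▷_
  data Circ (nZ : ℕ) : ℕ → Set a where
    []  : Circ nZ 0
    _▷_ : ∀ {m} → Circ nZ m → GateDef nZ m → Circ nZ (suc m)

  data Label (nZ : ℕ) : Set a where
    lvar   : Fin nZ → Label nZ
    lconst : Carrier → Label nZ
    lop    : OpLabel → Label nZ

  label : ∀ {nZ n} → Circ nZ n → Fin n → Label nZ
  label (c ▷ inVar z)   zero = lvar z
  label (c ▷ inConst x) zero = lconst x
  label (c ▷ op o _)    zero = lop o
  label (c ▷ _)     (suc j) = label c j

  children : ∀ {nZ n} → Circ nZ n → Fin n → List (Fin n)
  children (c ▷ op o cs)   zero = List.map suc cs
  children (c ▷ inVar _)   zero = []
  children (c ▷ inConst _) zero = []
  children (c ▷ _)     (suc j) = List.map suc (children c j)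

  evalGate : ∀ {nZ m} → Vec (Poly nZ) m → GateDef nZ m → Poly nZ
  evalGate vs (inVar z)        = varP z
  evalGate vs (inConst x)      = constP x
  evalGate vs (op plus cs)     = sumP  (List.map (lookup vs) cs)
  evalGate vs (op times cs)    = prodP (List.map (lookup vs) cs)

  values : ∀ {nZ n} → Circ nZ n → Vec (Poly nZ) n
  values []      = []
  values (c ▷ g) = evalGate (values c) g ∷ values c

  gateValue : ∀ {nZ n} → Circ nZ n → Fin n → Poly nZ
  gateValue c i = lookup (values c) i

  output : ∀ {nZ s} → Circ nZ (suc s) → Poly nZ
  output c = gateValue c zero

  -- Well-formedness: internal (+/×) gates have in-degree ≥ 1 and no
  -- repeated edges; every gate other than the output has an outgoing edge
  -- (so the output is the unique sink and the graph is connected).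
  WellFormed : ∀ {nZ s} → Circ nZ (suc s) → Set a
  WellFormed {s = s} c =
    (∀ i o → label c i ≡ lop o → Σ (Fin (suc s)) λ j → j ∈ children c i) ×
    (∀ i → Unique (children c i)) ×
    (∀ (j : Fin s) → Σ (Fin (suc s)) λ i → suc j ∈ children c i)

  SemanticDegreeAtMost : ∀ {nZ n} → ℕ → Circ nZ n → Set ℓ
  SemanticDegreeAtMost k c = ∀ i → DegreeAtMost k (gateValue c i)

  -- IPS over a system f_0,…,f_{m-1} ∈ F[X], X = Fin nX.
  -- Circuit variables: Z = X ⊎ Y encoded as Fin (nX + m); x_i is
  -- i ↑ˡ m, y_j is nX ↑ʳ j.

  module _ {nX m : ℕ} (fs : Fin m → Poly nX) where

    xvar : Fin nX → Poly (nX ℕ.+ m)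
    xvar i = varP (i ↑ˡ m)

    yvar : Fin m → Poly (nX ℕ.+ m)
    yvar j = varP (nX ↑ʳ j)

    atZero : Poly (nX ℕ.+ m) → Poly nX
    atZero C = substP C (λ z → [ varP , (λ _ → 0P) ]′ (splitAt nX z))

    atSystem : Poly (nX ℕ.+ m) → Poly nX
    atSystem C = substP C (λ z → [ varP , fs ]′ (splitAt nX z))

    IsIPSCertificate : Poly (nX ℕ.+ m) → Set ℓ
    IsIPSCertificate C = (atZero C ≈P 0P) × (atSystem C ≈P 1P)

    IsIPSRefutation : ∀ {s} → Circ (nX ℕ.+ m) (suc s) → Set (a ⊔ ℓ)
    IsIPSRefutation c = WellFormed c × IsIPSCertificate (output c)

    IsYLinear : ∀ {s} → Circ (nX ℕ.+ m) (suc s) → Set (a ⊔ ℓ)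
    IsYLinear c = Σ (Fin m → Poly nX) λ gs →
      output c ≈P sumP (List.map (λ i → yvar i *P substP (gs i) xvar) (allFin m))

  systemSize : (nX m : ℕ) → ℕ
  systemSize nX m = m ℕ.+ nX

  refutationSize : ∀ (nX m : ℕ) {s} → Circ (nX ℕ.+ m) (suc s) → ℕ
  refutationSize nX m {s} _ = suc s ℕ.⊔ (nX ℕ.+ m)

  module _ {g gℓ} {Γ : Group g gℓ} {nX : ℕ} (A : Action Γ nX) where
    open Action A
    open Group Γ using () renaming (Carrier to G)

    actPoly : G → Poly nX → Poly nX
    actPoly π f = substP f (λ x → varP (act π x))

    Invariant : ∀ {m} → (Fin m → Poly nX) → Set (g ⊔ ℓ)
    Invariant {m} fs = ∀ π (i : Fin m) → Σ (Fin m) λ j → actPoly π (fs i) ≈P fs j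

    -- the listed polynomials are pairwise distinct (𝓕 is a set)
    Distinct : ∀ {m} → (Fin m → Poly nX) → Set ℓ
    Distinct {m} fs = ∀ (i j : Fin m) → fs i ≈P fs j → i ≡ j

    -- labels of σ(g) vs. π(label g), where π acts on X by `act`,
    -- on Y by π(y_i) = y_j iff π(f_i) = f_j, and trivially on F.
    module _ {m : ℕ} (fs : Fin m → Poly nX) where

      LabelRel : G → Label (nX ℕ.+ m) → Label (nX ℕ.+ m) → Set (a ⊔ ℓ)
      LabelRel π (lvar z) l′ with splitAt nX z
      ... | inj₁ x = Lift (a ⊔ ℓ) (l′ ≡ lvar ((act π x) ↑ˡ m))
      ... | inj₂ i = Σ (Fin m) λ j → (actPoly π (fs i) ≈P fs j) × (l′ ≡ lvar (nX ↑ʳ j))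
      LabelRel π (lconst x) l′ = Σ Carrier λ y → (l′ ≡ lconst y) × (x ≈ y)
      LabelRel π (lop o) l′ = Lift (a ⊔ ℓ) (l′ ≡ lop o)

      IsExtendingAutomorphism : ∀ {n} → Circ (nX ℕ.+ m) n → G → (Fin n → Fin n) → Set (a ⊔ ℓ)
      IsExtendingAutomorphism {n} c π σ =
        (Σ (Fin n → Fin n) λ σ⁻¹ → (∀ i → σ (σ⁻¹ i) ≡ i) × (∀ i → σ⁻¹ (σ i) ≡ i)) ×
        (∀ u v → (u ∈ children c v → σ u ∈ children c (σ v)) ×
                 (σ u ∈ children c (σ v) → u ∈ children c v)) ×
        (∀ u → LabelRel π (label c u) (label c (σ u)))

      IsSymmetric : ∀ {n} → Circ (nX ℕ.+ m) n → Set (a ⊔ ℓ ⊔ g)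
      IsSymmetric {n} c = ∀ π → Σ (Fin n → Fin n) λ σ → IsExtendingAutomorphism c π σ

-- Average a certificate P over the group: Q = |Γ|⁻¹ Σ_π π·P, where π renames the x's and permutes
-- the y's as it permutes the equations (|Γ| is invertible by the assumption on the characteristic).
-- Evaluation at y = 0 and at y = f commutes with renaming, and the constants 0 and 1 are fixed,
-- so Q is again a certificate; its degree is still ≤ k and its coefficients are Γ-invariant.
-- Hence the circuit Σ_e Q_e x^e over all monomials e of degree ≤ k, built on k input copies
-- of each variable, is Γ-symmetric: π permutes copies and monomials and fixes the constants Q_e.
-- In N = |X| + |Y| variables there are at most (N+1)^k ≤ 2^k N^k such monomials.  Averaging also
-- keeps the form Σ_i y_i g_i(x), and certificates of degree 0 or without equations do not exist.

module Submission where

open import Defs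
open import Level using (Level; _⊔_; lift)
open import Algebra.Bundles using (Group; CommutativeMonoid; CommutativeSemiring)
import Algebra.Properties.CommutativeMonoid.Sum
open import Data.Nat as ℕ using (ℕ; zero; suc; _≤_; _<_; z≤n; s≤s)
import Data.Nat.Properties as ℕP
open import Data.Nat.DivMod using (_%_; _/_; m≡m%n+[m/n]*n; m%n<n)
open import Data.Nat.Divisibility using (_∣_; divides; ∣-refl)
open import Data.Fin as Fin using (Fin; zero; suc; _↑ˡ_; _↑ʳ_; splitAt; join; combine; remQuot; toℕ)
import Data.Fin.Properties as FinP
open import Data.Fin.Permutation as Perm using (Permutation′; _⟨$⟩ʳ_; _⟨$⟩ˡ_)
open import Data.Vec as Vec using (Vec; []; _∷_; lookup)
import Data.Vec.Properties as VecP
open import Data.List as List using (List; []; _∷_; _++_; length)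
import Data.List.Properties as ListP
open import Data.List.Membership.Propositional using (_∈_; _∉_)
import Data.List.Membership.Propositional.Properties as ∈P
open import Data.List.Relation.Unary.Any as Any using (here; there)
import Data.List.Relation.Unary.Any.Properties as AnyP
open import Data.List.Relation.Unary.All as All using (All; []; _∷_)
open import Data.List.Relation.Unary.AllPairs using ([]; _∷_)
open import Data.List.Relation.Unary.Unique.Propositional using (Unique)
import Data.List.Relation.Unary.Unique.Propositional.Properties as UniqueP
import Data.List.Relation.Unary.Unique.DecPropositional.Properties as UniqueDec
open import Data.Product using (Σ; _×_; _,_; proj₁; proj₂)
open import Data.Sum as Sum using (inj₁; inj₂; [_,_]′)
open import Data.Empty using (⊥; ⊥-elim)
open import Relation.Binary using (Setoid)
open import Relation.Binary.PropositionalEquality as ≡ using (_≡_; _≢_)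
import Relation.Binary.Reasoning.Setoid
open import Relation.Nullary using (Dec; yes; no; ¬_; contradiction)
open import Function using (_∘_; id; Injective; Injection)
open import Function.Properties.Inverse using (↔⇒↣)

module FinSum where

  ↑-elim : ∀ {L m p} (P : Fin (L ℕ.+ m) → Set p) → (∀ j → P (j ↑ˡ m)) → (∀ i → P (L ↑ʳ i)) → ∀ u → P u
  ↑-elim {L} {m} P new old u = ≡.subst P (FinP.join-splitAt L m u) (by-cases (splitAt L u))
    where
    by-cases : ∀ s → P (join L m s)
    by-cases (inj₁ j) = new j
    by-cases (inj₂ i) = old i

  ↑ˡ≢↑ʳ : ∀ {L m} (j : Fin L) (i : Fin m) → j ↑ˡ m ≢ L ↑ʳ i
  ↑ˡ≢↑ʳ zero    i ()
  ↑ˡ≢↑ʳ (suc j) i eq = ↑ˡ≢↑ʳ j i (FinP.suc-injective eq)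

  ∈-map-injective⁻ : ∀ {A B : Set} {f : A → B} → Injective _≡_ _≡_ f → ∀ {x xs} → f x ∈ List.map f xs → x ∈ xs
  ∈-map-injective⁻ f-inj fx∈ with ∈P.∈-map⁻ _ fx∈
  ... | y , y∈ , fx≡fy = ≡.subst (_∈ _) (≡.sym (f-inj fx≡fy)) y∈

  ↑ˡ∉map-↑ʳ : ∀ {L m} (j : Fin L) {xs : List (Fin m)} → j ↑ˡ m ∉ List.map (L ↑ʳ_) xs
  ↑ˡ∉map-↑ʳ j j∈ with ∈P.∈-map⁻ _ j∈
  ... | i , _ , j≡i = ↑ˡ≢↑ʳ j i j≡i

  ↑ʳ∉map-↑ˡ : ∀ {L m} (i : Fin m) {xs : List (Fin L)} → L ↑ʳ i ∉ List.map (_↑ˡ m) xs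
  ↑ʳ∉map-↑ˡ i i∈ with ∈P.∈-map⁻ _ i∈
  ... | j , _ , i≡j = ↑ˡ≢↑ʳ j i (≡.sym i≡j)

  blockMap : ∀ {L m} → (Fin L → Fin L) → (Fin m → Fin m) → Fin (L ℕ.+ m) → Fin (L ℕ.+ m)
  blockMap {L} {m} σL σm u = join L m (Sum.map σL σm (splitAt L u))

  blockMap-↑ˡ : ∀ {L m} (σL : Fin L → Fin L) (σm : Fin m → Fin m) j → blockMap σL σm (j ↑ˡ m) ≡ σL j ↑ˡ m
  blockMap-↑ˡ {L} {m} σL σm j rewrite FinP.splitAt-↑ˡ L j m = ≡.refl

  blockMap-↑ʳ : ∀ {L m} (σL : Fin L → Fin L) (σm : Fin m → Fin m) i → blockMap σL σm (L ↑ʳ i) ≡ L ↑ʳ σm i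
  blockMap-↑ʳ {L} {m} σL σm i rewrite FinP.splitAt-↑ʳ L m i = ≡.refl

  blockMap-inverse : ∀ {L m} (σL τL : Fin L → Fin L) (σm τm : Fin m → Fin m) →
    (∀ j → σL (τL j) ≡ j) → (∀ i → σm (τm i) ≡ i) → ∀ u → blockMap σL σm (blockMap τL τm u) ≡ u
  blockMap-inverse {L} {m} σL τL σm τm σLτL σmτm = ↑-elim _
    (λ j → ≡.trans (≡.cong (blockMap σL σm) (blockMap-↑ˡ τL τm j))
             (≡.trans (blockMap-↑ˡ σL σm (τL j)) (≡.cong (_↑ˡ m) (σLτL j))))
    (λ i → ≡.trans (≡.cong (blockMap σL σm) (blockMap-↑ʳ τL τm i))
             (≡.trans (blockMap-↑ʳ σL σm (τm i)) (≡.cong (L ↑ʳ_) (σmτm i))))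

module Monomials where
  open import Data.Nat using (_*_; _^_)

  incHead : ∀ {N} → Vec ℕ (suc N) → Vec ℕ (suc N)
  incHead (a ∷ v) = suc a ∷ v

  monomials : (N k : ℕ) → List (Vec ℕ N)
  monomials zero    k       = [] ∷ []
  monomials (suc N) zero    = Vec.replicate (suc N) 0 ∷ []
  monomials (suc N) (suc k) = List.map (0 ∷_) (monomials N (suc k)) ++ List.map incHead (monomials (suc N) k)

  sum≡0⇒zeros : ∀ {N} (v : Vec ℕ N) → Vec.sum v ≡ 0 → v ≡ Vec.replicate N 0
  sum≡0⇒zeros []           _   = ≡.refl
  sum≡0⇒zeros (zero ∷ v) sum≡0 = ≡.cong (0 ∷_) (sum≡0⇒zeros v sum≡0)

  sum-zeros : ∀ N → Vec.sum (Vec.replicate N 0) ≡ 0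
  sum-zeros zero    = ≡.refl
  sum-zeros (suc N) = sum-zeros N

  monomials-complete : ∀ N k (e : Vec ℕ N) → Vec.sum e ≤ k → e ∈ monomials N k
  monomials-complete zero    k       []          _       = here ≡.refl
  monomials-complete (suc N) zero    e           e≤0     = here (sum≡0⇒zeros e (ℕP.n≤0⇒n≡0 e≤0))
  monomials-complete (suc N) (suc k) (zero ∷ v)  v≤      =
    ∈P.∈-++⁺ˡ (∈P.∈-map⁺ (0 ∷_) (monomials-complete N (suc k) v v≤))
  monomials-complete (suc N) (suc k) (suc a ∷ v) (s≤s e≤) =
    ∈P.∈-++⁺ʳ _ (∈P.∈-map⁺ incHead (monomials-complete (suc N) k (a ∷ v) e≤))

  monomials-sound : ∀ N k (e : Vec ℕ N) → e ∈ monomials N k → Vec.sum e ≤ k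
  monomials-sound zero    k       []  _             = z≤n
  monomials-sound (suc N) zero    e   (here ≡.refl) = ℕP.≤-reflexive (sum-zeros N)
  monomials-sound (suc N) (suc k) e   e∈ with ∈P.∈-++⁻ (List.map (0 ∷_) (monomials N (suc k))) e∈
  ... | inj₁ e∈₀ with ∈P.∈-map⁻ (0 ∷_) e∈₀
  ...   | v , v∈ , ≡.refl = monomials-sound N (suc k) v v∈
  monomials-sound (suc N) (suc k) e e∈ | inj₂ e∈₁ with ∈P.∈-map⁻ incHead e∈₁
  ...   | a ∷ v , v∈ , ≡.refl = s≤s (monomials-sound (suc N) k (a ∷ v) v∈)

  monomials-unique : ∀ N k → Unique (monomials N k)
  monomials-unique zero    k       = [] ∷ []
  monomials-unique (suc N) zero    = [] ∷ []
  monomials-unique (suc N) (suc k) =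
    UniqueP.++⁺ (UniqueP.map⁺ ∷-injectiveʳ (monomials-unique N (suc k)))
                (UniqueP.map⁺ incHead-injective (monomials-unique (suc N) k)) disjoint
    where
    ∷-injectiveʳ : ∀ {x y : Vec ℕ N} → (0 ∷ x) ≡ (0 ∷ y) → x ≡ y
    ∷-injectiveʳ ≡.refl = ≡.refl
    incHead-injective : ∀ {x y : Vec ℕ (suc N)} → incHead x ≡ incHead y → x ≡ y
    incHead-injective {_ ∷ _} {_ ∷ _} ≡.refl = ≡.refl
    disjoint : ∀ {v} → v ∈ List.map (0 ∷_) (monomials N (suc k)) × v ∈ List.map incHead (monomials (suc N) k) → ⊥
    disjoint (v∈₀ , v∈₁) with ∈P.∈-map⁻ (0 ∷_) v∈₀ | ∈P.∈-map⁻ incHead v∈₁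
    ... | _ , _ , ≡.refl | _ ∷ _ , _ , ()

  length-monomials : ∀ N k → length (monomials N k) ≤ suc N ^ k
  length-monomials zero    k       = ℕP.≤-reflexive (≡.sym (ℕP.^-zeroˡ k))
  length-monomials (suc N) zero    = ℕP.≤-refl
  length-monomials (suc N) (suc k) = begin
    length (List.map (0 ∷_) (monomials N (suc k)) ++ List.map incHead (monomials (suc N) k))
      ≡⟨ ListP.length-++ (List.map (0 ∷_) (monomials N (suc k))) ⟩
    length (List.map (0 ∷_) (monomials N (suc k))) ℕ.+ length (List.map incHead (monomials (suc N) k))
      ≡⟨ ≡.cong₂ ℕ._+_ (ListP.length-map (0 ∷_) (monomials N (suc k))) (ListP.length-map incHead (monomials (suc N) k)) ⟩
    length (monomials N (suc k)) ℕ.+ length (monomials (suc N) k)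
      ≤⟨ ℕP.+-mono-≤ (length-monomials N (suc k)) (length-monomials (suc N) k) ⟩
    suc N * suc N ^ k ℕ.+ suc (suc N) ^ k
      ≤⟨ ℕP.+-monoˡ-≤ _ (ℕP.*-monoʳ-≤ (suc N) (ℕP.^-monoˡ-≤ k (ℕP.n≤1+n (suc N)))) ⟩
    suc N * suc (suc N) ^ k ℕ.+ suc (suc N) ^ k
      ≡⟨ ℕP.+-comm (suc N * suc (suc N) ^ k) (suc (suc N) ^ k) ⟩
    suc (suc N) ^ suc k ∎
    where open ℕP.≤-Reasoning

  lookup-injective : ∀ {A : Set} (xs : List A) → Unique xs → ∀ {i j} → List.lookup xs i ≡ List.lookup xs j → i ≡ j
  lookup-injective (x ∷ xs) (x∉ ∷ xs!) {zero}  {zero}  _  = ≡.refl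
  lookup-injective (x ∷ xs) (x∉ ∷ xs!) {zero}  {suc j} eq =
    ⊥-elim (All.lookup x∉ (≡.subst (_∈ xs) (≡.sym eq) (∈P.∈-lookup j)) ≡.refl)
  lookup-injective (x ∷ xs) (x∉ ∷ xs!) {suc i} {zero}  eq =
    ⊥-elim (All.lookup x∉ (≡.subst (_∈ xs) eq (∈P.∈-lookup i)) ≡.refl)
  lookup-injective (x ∷ xs) (x∉ ∷ xs!) {suc i} {suc j} eq = ≡.cong suc (lookup-injective xs xs! eq)

  lookup-index : ∀ {A : Set} {xs : List A} {x} (x∈ : x ∈ xs) → List.lookup xs (Any.index x∈) ≡ x
  lookup-index x∈ = ≡.sym (AnyP.lookup-index x∈)

module BelowFin where
  below : ℕ → (k : ℕ) → List (Fin k)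
  below zero    k       = []
  below (suc j) zero    = []
  below (suc j) (suc k) = zero ∷ List.map suc (below j k)

  length-below : ∀ {j k} → j ≤ k → length (below j k) ≡ j
  length-below {zero}              _       = ≡.refl
  length-below {suc j} {suc k} (s≤s j≤k) = ≡.cong suc (≡.trans (ListP.length-map suc (below j k)) (length-below j≤k))

  ∈-below⁺ : ∀ {j k} (r : Fin k) → toℕ r < j → r ∈ below j k
  ∈-below⁺ {suc j} {suc k} zero    _         = here ≡.refl
  ∈-below⁺ {suc j} {suc k} (suc r) (s≤s r<j) = there (∈P.∈-map⁺ suc (∈-below⁺ r r<j))

  ∈-below⁻ : ∀ {j k} (r : Fin k) → r ∈ below j k → toℕ r < j
  ∈-below⁻ {suc j} {suc k} zero    _            = s≤s z≤n
  ∈-below⁻ {suc j} {suc k} (suc r) (there r∈) = s≤s (∈-below⁻ r (FinSum.∈-map-injective⁻ FinP.suc-injective r∈))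

  below-unique : ∀ j k → Unique (below j k)
  below-unique zero    k       = []
  below-unique (suc j) zero    = []
  below-unique (suc j) (suc k) = All.tabulate zero∉ ∷ UniqueP.map⁺ FinP.suc-injective (below-unique j k)
    where
    zero∉ : ∀ {x} → x ∈ List.map suc (below j k) → zero ≢ x
    zero∉ x∈ ≡.refl with ∈P.∈-map⁻ suc x∈
    ... | _ , _ , ()

module Polynomials {a ℓ : Level} (F : Field a ℓ) where
  open Field F hiding (zero)
  open Monomials using (sum≡0⇒zeros; sum-zeros)
  open import Relation.Binary.Reasoning.Setoid setoid
  open import Algebra.Properties.CommutativeSemigroup +-commutativeSemigroup using (interchange)

  Pol : ℕ → Set a
  Pol = Poly F

  Exponent : ℕ → Set
  Exponent = Vec ℕ

  -- A record rather than _≈P_ itself, so that both polynomials can be inferred from a proof.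
  infix 4 _≈ₚ_
  record _≈ₚ_ {n} (p q : Pol n) : Set ℓ where
    constructor mk≈
    field coeff-≈ : _≈P_ F p q
  open _≈ₚ_ public

  infixl 6 _+ₚ_
  infixl 7 _*ₚ_
  infixr 8 _^ₚ_

  coeffₚ : ∀ {n} → Pol n → Exponent n → Carrier
  coeffₚ = coeff F

  _+ₚ_ _*ₚ_ : ∀ {n} → Pol n → Pol n → Pol n
  _+ₚ_ = _+P_ F
  _*ₚ_ = _*P_ F

  0ₚ 1ₚ : ∀ {n} → Pol n
  0ₚ = 0P F
  1ₚ = 1P F

  constₚ : ∀ {n} → Carrier → Pol n
  constₚ = constP F

  varₚ : ∀ {n} → Fin n → Pol n
  varₚ = varP F

  _^ₚ_ : ∀ {n} → Pol n → ℕ → Pol n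
  _^ₚ_ = powP F

  monoSubstₚ : ∀ {n k} → Exponent n → (Fin n → Pol k) → Pol k
  monoSubstₚ = monoSubst F

  substₚ : ∀ {n k} → Pol n → (Fin n → Pol k) → Pol k
  substₚ = substP F

  zeros : ∀ {n} → Exponent n
  zeros = Vec.replicate _ 0

  infixl 6 _⊕_
  _⊕_ : ∀ {n} → Exponent n → Exponent n → Exponent n
  _⊕_ = Vec.zipWith ℕ._+_

  _≟ᵉ_ : ∀ {n} (d e : Exponent n) → Dec (d ≡ e)
  _≟ᵉ_ = VecP.≡-dec ℕP._≟_

  δ : ∀ {n} → Exponent n → Exponent n → Carrier
  δ e d with d ≟ᵉ e
  ... | yes _ = 1#
  ... | no  _ = 0#

  δ-refl : ∀ {n} (d : Exponent n) → δ d d ≈ 1#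
  δ-refl d with d ≟ᵉ d
  ... | yes _  = refl
  ... | no d≢d = contradiction ≡.refl d≢d

  δ-≢ : ∀ {n} {e d : Exponent n} → d ≢ e → δ e d ≈ 0#
  δ-≢ {e = e} {d} d≢e with d ≟ᵉ e
  ... | yes d≡e = contradiction d≡e d≢e
  ... | no  _   = refl

  -- Identities between polynomials are proved by pairing both sides with an arbitrary φ:
  -- pairing turns +ₚ, *ₚ and substitution into sums, and φ = δ e recovers coefficients.
  pairing : ∀ {n} → Pol n → (Exponent n → Carrier) → Carrier
  pairing []             φ = 0#
  pairing (term c d ∷ p) φ = c * φ d + pairing p φ

  coeff≈pairing-δ : ∀ {n} (p : Pol n) e → coeffₚ p e ≈ pairing p (δ e)
  coeff≈pairing-δ []             e = refl
  coeff≈pairing-δ (term c d ∷ p) e with d ≟ᵉ e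
  ... | yes _ = +-cong (sym (*-identityʳ c)) (coeff≈pairing-δ p e)
  ... | no  _ = begin
    coeffₚ p e               ≈⟨ coeff≈pairing-δ p e ⟩
    pairing p (δ e)          ≈⟨ +-identityˡ _ ⟨
    0# + pairing p (δ e)     ≈⟨ +-congʳ (zeroʳ c) ⟨
    c * 0# + pairing p (δ e) ∎

  pairing-congʳ : ∀ {n} (p : Pol n) {φ ψ} → (∀ d → φ d ≈ ψ d) → pairing p φ ≈ pairing p ψ
  pairing-congʳ []             φ≈ψ = refl
  pairing-congʳ (term c d ∷ p) φ≈ψ = +-cong (*-congˡ (φ≈ψ d)) (pairing-congʳ p φ≈ψ)

  pairing-≗ʳ : ∀ {n} (p : Pol n) {φ ψ} → (∀ d → φ d ≡ ψ d) → pairing p φ ≈ pairing p ψ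
  pairing-≗ʳ p φ≗ψ = pairing-congʳ p (λ d → reflexive (φ≗ψ d))

  pairing-+ʳ : ∀ {n} (p : Pol n) φ ψ → pairing p (λ d → φ d + ψ d) ≈ pairing p φ + pairing p ψ
  pairing-+ʳ []             φ ψ = sym (+-identityʳ 0#)
  pairing-+ʳ (term c d ∷ p) φ ψ =
    trans (+-cong (distribˡ c (φ d) (ψ d)) (pairing-+ʳ p φ ψ)) (interchange _ _ _ _)

  pairing-*ʳ : ∀ {n} (p : Pol n) c φ → pairing p (λ d → c * φ d) ≈ c * pairing p φ
  pairing-*ʳ []              c φ = sym (zeroʳ c)
  pairing-*ʳ (term c′ d ∷ p) c φ = begin
    c′ * (c * φ d) + pairing p (λ d → c * φ d) ≈⟨ +-cong (x∙yz≈y∙xz c′ c (φ d)) (pairing-*ʳ p c φ) ⟩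
    c * (c′ * φ d) + c * pairing p φ           ≈⟨ distribˡ c _ _ ⟨
    c * (c′ * φ d + pairing p φ)               ∎
    where open import Algebra.Properties.CommutativeSemigroup *-commutativeSemigroup using (x∙yz≈y∙xz)

  pairing-0ʳ : ∀ {n} (p : Pol n) {φ} → (∀ d → φ d ≈ 0#) → pairing p φ ≈ 0#
  pairing-0ʳ []             φ≈0 = refl
  pairing-0ʳ (term c d ∷ p) φ≈0 =
    trans (+-cong (trans (*-congˡ (φ≈0 d)) (zeroʳ c)) (pairing-0ʳ p φ≈0)) (+-identityʳ 0#)

  pairing-++ : ∀ {n} (p q : Pol n) φ → pairing (p ++ q) φ ≈ pairing p φ + pairing q φ
  pairing-++ []             q φ = sym (+-identityˡ _)
  pairing-++ (term c d ∷ p) q φ = trans (+-congˡ (pairing-++ p q φ)) (sym (+-assoc _ _ _))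

  pairing-comm : ∀ {n k} (p : Pol n) (q : Pol k) (ψ : Exponent n → Exponent k → Carrier) →
    pairing p (λ d → pairing q (ψ d)) ≈ pairing q (λ d′ → pairing p (λ d → ψ d d′))
  pairing-comm []             q ψ = sym (pairing-0ʳ q (λ _ → refl))
  pairing-comm (term c d ∷ p) q ψ = begin
    c * pairing q (ψ d) + pairing p (λ d₁ → pairing q (ψ d₁))
      ≈⟨ +-cong (sym (pairing-*ʳ q c (ψ d))) (pairing-comm p q ψ) ⟩
    pairing q (λ d′ → c * ψ d d′) + pairing q (λ d′ → pairing p (λ d₁ → ψ d₁ d′))
      ≈⟨ pairing-+ʳ q _ _ ⟨
    pairing q (λ d′ → c * ψ d d′ + pairing p (λ d₁ → ψ d₁ d′)) ∎

  exponents : ∀ {n} → Pol n → List (Exponent n)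
  exponents = List.map Term.expo

  module _ {n : ℕ} where
    sumOver : List (Exponent n) → (Exponent n → Carrier) → Carrier
    sumOver []      f = 0#
    sumOver (d ∷ E) f = f d + sumOver E f

    sumOver-cong : ∀ E {f g} → (∀ d → f d ≈ g d) → sumOver E f ≈ sumOver E g
    sumOver-cong []      f≈g = refl
    sumOver-cong (d ∷ E) f≈g = +-cong (f≈g d) (sumOver-cong E f≈g)

    sumOver-+ : ∀ E f g → sumOver E (λ d → f d + g d) ≈ sumOver E f + sumOver E g
    sumOver-+ []      f g = sym (+-identityʳ 0#)
    sumOver-+ (d ∷ E) f g = trans (+-congˡ (sumOver-+ E f g)) (interchange _ _ _ _)

    sumOver-* : ∀ E c f → sumOver E (λ d → c * f d) ≈ c * sumOver E f
    sumOver-* []      c f = sym (zeroʳ c)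
    sumOver-* (d ∷ E) c f = trans (+-congˡ (sumOver-* E c f)) (sym (distribˡ c _ _))

    sumOver-0 : ∀ E f → All (λ d → f d ≈ 0#) E → sumOver E f ≈ 0#
    sumOver-0 []      f []            = refl
    sumOver-0 (d ∷ E) f (fd≈0 ∷ f≈0) = trans (+-cong fd≈0 (sumOver-0 E f f≈0)) (+-identityʳ 0#)

    sumOver-δ : ∀ E → Unique E → ∀ {d} → d ∈ E → ∀ (ψ : Exponent n → Carrier) → sumOver E (λ d′ → δ d′ d * ψ d′) ≈ ψ d
    sumOver-δ (d ∷ E) (d∉E ∷ _) (here ≡.refl) ψ = begin
      δ d d * ψ d + sumOver E (λ d′ → δ d′ d * ψ d′) ≈⟨ +-congˡ (sumOver-0 E _ (All.map δ≈0 d∉E)) ⟩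
      δ d d * ψ d + 0#                               ≈⟨ +-identityʳ _ ⟩
      δ d d * ψ d                                    ≈⟨ *-congʳ (δ-refl d) ⟩
      1# * ψ d                                       ≈⟨ *-identityˡ _ ⟩
      ψ d                                            ∎
      where
      δ≈0 : ∀ {d′} → d ≢ d′ → δ d′ d * ψ d′ ≈ 0#
      δ≈0 d≢d′ = trans (*-congʳ (δ-≢ d≢d′)) (zeroˡ _)
    sumOver-δ (d′ ∷ E) (d′∉E ∷ E!) {d} (there d∈E) ψ = begin
      δ d′ d * ψ d′ + sumOver E (λ d″ → δ d″ d * ψ d″) ≈⟨ +-congʳ (trans (*-congʳ (δ-≢ d≢d′)) (zeroˡ _)) ⟩
      0# + sumOver E (λ d″ → δ d″ d * ψ d″)            ≈⟨ +-identityˡ _ ⟩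
      sumOver E (λ d″ → δ d″ d * ψ d″)                 ≈⟨ sumOver-δ E E! d∈E ψ ⟩
      ψ d                                              ∎
      where
      d≢d′ : d ≢ d′
      d≢d′ d≡d′ = All.lookup d′∉E d∈E (≡.sym d≡d′)

    pairing≈sumOver : ∀ (p : Pol n) E → Unique E → (∀ {d} → d ∈ exponents p → d ∈ E) →
      ∀ φ → pairing p φ ≈ sumOver E (λ d → coeffₚ p d * φ d)
    pairing≈sumOver [] E E! ⊆E φ = sym (sumOver-0 E _ (All.tabulate (λ _ → zeroˡ _)))
    pairing≈sumOver (term c d ∷ p) E E! ⊆E φ = begin
      c * φ d + pairing p φ
        ≈⟨ +-cong (*-congˡ (sym (sumOver-δ E E! (⊆E (here ≡.refl)) φ))) (pairing≈sumOver p E E! (⊆E ∘ there) φ) ⟩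
      c * sumOver E (λ d′ → δ d′ d * φ d′) + sumOver E (λ d′ → coeffₚ p d′ * φ d′)
        ≈⟨ +-congʳ (sumOver-* E c _) ⟨
      sumOver E (λ d′ → c * (δ d′ d * φ d′)) + sumOver E (λ d′ → coeffₚ p d′ * φ d′)
        ≈⟨ sumOver-+ E _ _ ⟨
      sumOver E (λ d′ → c * (δ d′ d * φ d′) + coeffₚ p d′ * φ d′)
        ≈⟨ sumOver-cong E term-coeff ⟩
      sumOver E (λ d′ → coeffₚ (term c d ∷ p) d′ * φ d′) ∎
      where
      term-coeff : ∀ d′ → c * (δ d′ d * φ d′) + coeffₚ p d′ * φ d′ ≈ coeffₚ (term c d ∷ p) d′ * φ d′
      term-coeff d′ with d ≟ᵉ d′
      ... | yes _ = trans (+-congʳ (*-congˡ (*-identityˡ _))) (sym (distribʳ _ _ _))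
      ... | no  _ = trans (+-congʳ (trans (*-congˡ (zeroˡ _)) (zeroʳ c))) (+-identityˡ _)

  pairing-cong : ∀ {n} {p q : Pol n} → p ≈ₚ q → ∀ φ → pairing p φ ≈ pairing q φ
  pairing-cong {n} {p} {q} (mk≈ p≈q) φ = begin
    pairing p φ                        ≈⟨ pairing≈sumOver p E E! (λ d∈ → ∈-E (∈P.∈-++⁺ˡ d∈)) φ ⟩
    sumOver E (λ d → coeffₚ p d * φ d) ≈⟨ sumOver-cong E (λ d → *-congʳ (p≈q d)) ⟩
    sumOver E (λ d → coeffₚ q d * φ d) ≈⟨ pairing≈sumOver q E E! (λ d∈ → ∈-E (∈P.∈-++⁺ʳ (exponents p) d∈)) φ ⟨
    pairing q φ                        ∎
    where
    E = List.deduplicate _≟ᵉ_ (exponents p ++ exponents q)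
    E! : Unique E
    E! = UniqueDec.deduplicate-! _≟ᵉ_ (exponents p ++ exponents q)
    ∈-E : ∀ {d} → d ∈ exponents p ++ exponents q → d ∈ E
    ∈-E = ∈P.∈-deduplicate⁺ _≟ᵉ_

  ≈ₚ-by-pairing : ∀ {n} {p q : Pol n} → (∀ φ → pairing p φ ≈ pairing q φ) → p ≈ₚ q
  ≈ₚ-by-pairing {p = p} {q} h = mk≈ λ e →
    trans (coeff≈pairing-δ p e) (trans (h (δ e)) (sym (coeff≈pairing-δ q e)))

  ≈ₚ-refl : ∀ {n} {p : Pol n} → p ≈ₚ p
  ≈ₚ-refl = mk≈ λ e → refl

  ≈ₚ-sym : ∀ {n} {p q : Pol n} → p ≈ₚ q → q ≈ₚ p
  ≈ₚ-sym (mk≈ p≈q) = mk≈ λ e → sym (p≈q e)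

  ≈ₚ-trans : ∀ {n} {p q r : Pol n} → p ≈ₚ q → q ≈ₚ r → p ≈ₚ r
  ≈ₚ-trans (mk≈ p≈q) (mk≈ q≈r) = mk≈ λ e → trans (p≈q e) (q≈r e)

  ≈ₚ-reflexive : ∀ {n} {p q : Pol n} → p ≡ q → p ≈ₚ q
  ≈ₚ-reflexive ≡.refl = ≈ₚ-refl

  Pol-setoid : ℕ → Setoid a ℓ
  Pol-setoid n = record
    { Carrier       = Pol n
    ; _≈_           = _≈ₚ_
    ; isEquivalence = record { refl = ≈ₚ-refl ; sym = ≈ₚ-sym ; trans = ≈ₚ-trans }
    }

  module ≈ₚ-Reasoning {n : ℕ} = Relation.Binary.Reasoning.Setoid (Pol-setoid n)

  pairing-*ₚ : ∀ {n} (p q : Pol n) φ → pairing (p *ₚ q) φ ≈ pairing p (λ d → pairing q (λ d′ → φ (d ⊕ d′)))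
  pairing-*ₚ []             q φ = refl
  pairing-*ₚ (term c d ∷ p) q φ =
    trans (pairing-++ (List.map (λ t → term (c * Term.coef t) (d ⊕ Term.expo t)) q) (p *ₚ q) φ)
          (+-cong (shifted q) (pairing-*ₚ p q φ))
    where
    shifted : ∀ q → pairing (List.map (λ t → term (c * Term.coef t) (d ⊕ Term.expo t)) q) φ
                    ≈ c * pairing q (λ d′ → φ (d ⊕ d′))
    shifted []              = sym (zeroʳ c)
    shifted (term c′ d′ ∷ q) = trans (+-cong (*-assoc c c′ _) (shifted q)) (sym (distribˡ c _ _))

  pairing-const : ∀ {n} c φ → pairing (constₚ {n} c) φ ≈ c * φ zeros
  pairing-const c φ = +-identityʳ _

  pairing-const* : ∀ {n} c (q : Pol n) φ → pairing (constₚ c *ₚ q) φ ≈ c * pairing q φ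
  pairing-const* c q φ = trans (pairing-*ₚ (constₚ c) q φ)
    (trans (pairing-const c (λ d → pairing q (λ d′ → φ (d ⊕ d′))))
           (*-congˡ (pairing-≗ʳ q (λ d → ≡.cong φ (VecP.zipWith-identityˡ {f = ℕ._+_} ℕP.+-identityˡ d)))))

  +ₚ-cong : ∀ {n} {p p′ q q′ : Pol n} → p ≈ₚ p′ → q ≈ₚ q′ → p +ₚ q ≈ₚ p′ +ₚ q′
  +ₚ-cong {p = p} {p′} {q} {q′} p≈p′ q≈q′ = ≈ₚ-by-pairing λ φ →
    trans (pairing-++ p q φ) (trans (+-cong (pairing-cong p≈p′ φ) (pairing-cong q≈q′ φ)) (sym (pairing-++ p′ q′ φ)))

  +ₚ-comm : ∀ {n} (p q : Pol n) → p +ₚ q ≈ₚ q +ₚ p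
  +ₚ-comm p q = ≈ₚ-by-pairing λ φ → trans (pairing-++ p q φ) (trans (+-comm _ _) (sym (pairing-++ q p φ)))

  +ₚ-assoc : ∀ {n} (p q r : Pol n) → (p +ₚ q) +ₚ r ≈ₚ p +ₚ (q +ₚ r)
  +ₚ-assoc p q r = ≈ₚ-reflexive (ListP.++-assoc p q r)

  +ₚ-identityʳ : ∀ {n} (p : Pol n) → p +ₚ 0ₚ ≈ₚ p
  +ₚ-identityʳ p = ≈ₚ-reflexive (ListP.++-identityʳ p)

  *ₚ-congˡ : ∀ {n} (p : Pol n) {q q′ : Pol n} → q ≈ₚ q′ → p *ₚ q ≈ₚ p *ₚ q′
  *ₚ-congˡ p {q} {q′} q≈q′ = ≈ₚ-by-pairing λ φ →
    trans (pairing-*ₚ p q φ) (trans (pairing-congʳ p (λ d → pairing-cong q≈q′ _)) (sym (pairing-*ₚ p q′ φ)))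

  *ₚ-congʳ : ∀ {n} (q : Pol n) {p p′ : Pol n} → p ≈ₚ p′ → p *ₚ q ≈ₚ p′ *ₚ q
  *ₚ-congʳ q {p} {p′} p≈p′ = ≈ₚ-by-pairing λ φ →
    trans (pairing-*ₚ p q φ) (trans (pairing-cong p≈p′ _) (sym (pairing-*ₚ p′ q φ)))

  *ₚ-cong : ∀ {n} {p p′ q q′ : Pol n} → p ≈ₚ p′ → q ≈ₚ q′ → p *ₚ q ≈ₚ p′ *ₚ q′
  *ₚ-cong {p′ = p′} {q} p≈p′ q≈q′ = ≈ₚ-trans (*ₚ-congʳ q p≈p′) (*ₚ-congˡ p′ q≈q′)

  *ₚ-comm : ∀ {n} (p q : Pol n) → p *ₚ q ≈ₚ q *ₚ p
  *ₚ-comm p q = ≈ₚ-by-pairing λ φ → begin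
    pairing (p *ₚ q) φ                                 ≈⟨ pairing-*ₚ p q φ ⟩
    pairing p (λ d → pairing q (λ d′ → φ (d ⊕ d′)))   ≈⟨ pairing-comm p q _ ⟩
    pairing q (λ d′ → pairing p (λ d → φ (d ⊕ d′)))   ≈⟨ pairing-congʳ q (λ d′ → pairing-≗ʳ p (λ d → ≡.cong φ (⊕-comm d d′))) ⟩
    pairing q (λ d′ → pairing p (λ d → φ (d′ ⊕ d)))   ≈⟨ pairing-*ₚ q p φ ⟨
    pairing (q *ₚ p) φ                                 ∎
    where ⊕-comm = VecP.zipWith-comm ℕP.+-comm

  *ₚ-assoc : ∀ {n} (p q r : Pol n) → (p *ₚ q) *ₚ r ≈ₚ p *ₚ (q *ₚ r)
  *ₚ-assoc p q r = ≈ₚ-by-pairing λ φ → begin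
    pairing ((p *ₚ q) *ₚ r) φ
      ≈⟨ trans (pairing-*ₚ (p *ₚ q) r φ) (pairing-*ₚ p q _) ⟩
    pairing p (λ d₁ → pairing q (λ d₂ → pairing r (λ d₃ → φ ((d₁ ⊕ d₂) ⊕ d₃))))
      ≈⟨ pairing-congʳ p (λ d₁ → pairing-congʳ q (λ d₂ → pairing-≗ʳ r (λ d₃ → ≡.cong φ (⊕-assoc d₁ d₂ d₃)))) ⟩
    pairing p (λ d₁ → pairing q (λ d₂ → pairing r (λ d₃ → φ (d₁ ⊕ (d₂ ⊕ d₃)))))
      ≈⟨ trans (pairing-*ₚ p (q *ₚ r) φ) (pairing-congʳ p (λ d₁ → pairing-*ₚ q r _)) ⟨
    pairing (p *ₚ (q *ₚ r)) φ ∎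
    where ⊕-assoc = VecP.zipWith-assoc ℕP.+-assoc

  *ₚ-distribʳ : ∀ {n} (q p p′ : Pol n) → (p +ₚ p′) *ₚ q ≈ₚ p *ₚ q +ₚ p′ *ₚ q
  *ₚ-distribʳ q p p′ = ≈ₚ-by-pairing λ φ → begin
    pairing ((p +ₚ p′) *ₚ q) φ                ≈⟨ trans (pairing-*ₚ (p +ₚ p′) q φ) (pairing-++ p p′ _) ⟩
    pairing p _ + pairing p′ _                ≈⟨ +-cong (pairing-*ₚ p q φ) (pairing-*ₚ p′ q φ) ⟨
    pairing (p *ₚ q) φ + pairing (p′ *ₚ q) φ ≈⟨ pairing-++ (p *ₚ q) (p′ *ₚ q) φ ⟨
    pairing (p *ₚ q +ₚ p′ *ₚ q) φ            ∎

  *ₚ-distribˡ : ∀ {n} (p q q′ : Pol n) → p *ₚ (q +ₚ q′) ≈ₚ p *ₚ q +ₚ p *ₚ q′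
  *ₚ-distribˡ p q q′ = ≈ₚ-trans (*ₚ-comm p (q +ₚ q′))
    (≈ₚ-trans (*ₚ-distribʳ p q q′) (+ₚ-cong (*ₚ-comm q p) (*ₚ-comm q′ p)))

  *ₚ-identityˡ : ∀ {n} (q : Pol n) → 1ₚ *ₚ q ≈ₚ q
  *ₚ-identityˡ q = ≈ₚ-by-pairing λ φ → trans (pairing-const* 1# q φ) (*-identityˡ _)

  *ₚ-identityʳ : ∀ {n} (q : Pol n) → q *ₚ 1ₚ ≈ₚ q
  *ₚ-identityʳ q = ≈ₚ-trans (*ₚ-comm q 1ₚ) (*ₚ-identityˡ q)

  *ₚ-zeroʳ : ∀ {n} (p : Pol n) → p *ₚ 0ₚ ≈ₚ 0ₚ
  *ₚ-zeroʳ p = ≈ₚ-by-pairing λ φ → trans (pairing-*ₚ p 0ₚ φ) (pairing-0ʳ p (λ _ → refl))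

  Pol-commutativeSemiring : ℕ → CommutativeSemiring a ℓ
  Pol-commutativeSemiring n = record
    { Carrier = Pol n
    ; _≈_ = _≈ₚ_
    ; _+_ = _+ₚ_
    ; _*_ = _*ₚ_
    ; 0# = 0ₚ
    ; 1# = 1ₚ
    ; isCommutativeSemiring = record
      { isSemiring = record
        { isSemiringWithoutAnnihilatingZero = record
          { +-isCommutativeMonoid = record
            { isMonoid = record
              { isSemigroup = record
                { isMagma = record
                  { isEquivalence = Setoid.isEquivalence (Pol-setoid n)
                  ; ∙-cong = +ₚ-cong }
                ; assoc = +ₚ-assoc }
              ; identity = (λ _ → ≈ₚ-refl) , +ₚ-identityʳ }
            ; comm = +ₚ-comm }
          ; *-cong = *ₚ-cong
          ; *-assoc = *ₚ-assoc
          ; *-identity = *ₚ-identityˡ , *ₚ-identityʳ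
          ; distrib = *ₚ-distribˡ , *ₚ-distribʳ }
        ; zero = (λ _ → ≈ₚ-refl) , *ₚ-zeroʳ }
      ; *-comm = *ₚ-comm }
    }

  coeff-+ₚ : ∀ {n} (p q : Pol n) e → coeffₚ (p +ₚ q) e ≈ coeffₚ p e + coeffₚ q e
  coeff-+ₚ p q e = trans (coeff≈pairing-δ (p +ₚ q) e)
    (trans (pairing-++ p q _) (sym (+-cong (coeff≈pairing-δ p e) (coeff≈pairing-δ q e))))

  coeff-const* : ∀ {n} c (q : Pol n) e → coeffₚ (constₚ c *ₚ q) e ≈ c * coeffₚ q e
  coeff-const* c q e = trans (coeff≈pairing-δ (constₚ c *ₚ q) e)
    (trans (pairing-const* c q _) (*-congˡ (sym (coeff≈pairing-δ q e))))

  pairing-subst : ∀ {n k} (p : Pol n) (σ : Fin n → Pol k) φ →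
    pairing (substₚ p σ) φ ≈ pairing p (λ d → pairing (monoSubstₚ d σ) φ)
  pairing-subst []             σ φ = refl
  pairing-subst (term c d ∷ p) σ φ = trans (pairing-++ (constₚ c *ₚ monoSubstₚ d σ) (substₚ p σ) φ)
    (+-cong (pairing-const* c (monoSubstₚ d σ) φ) (pairing-subst p σ φ))

  subst-cong : ∀ {n k} {p q : Pol n} (σ : Fin n → Pol k) → p ≈ₚ q → substₚ p σ ≈ₚ substₚ q σ
  subst-cong {p = p} {q} σ p≈q = ≈ₚ-by-pairing λ φ →
    trans (pairing-subst p σ φ) (trans (pairing-cong p≈q _) (sym (pairing-subst q σ φ)))

  ^ₚ-cong : ∀ {n} {p q : Pol n} e → p ≈ₚ q → p ^ₚ e ≈ₚ q ^ₚ e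
  ^ₚ-cong zero    p≈q = ≈ₚ-refl
  ^ₚ-cong (suc e) p≈q = *ₚ-cong p≈q (^ₚ-cong e p≈q)

  monoSubst-cong : ∀ {n k} (d : Exponent n) {σ τ : Fin n → Pol k} → (∀ z → σ z ≈ₚ τ z) →
    monoSubstₚ d σ ≈ₚ monoSubstₚ d τ
  monoSubst-cong []      σ≈τ = ≈ₚ-refl
  monoSubst-cong (e ∷ d) σ≈τ = *ₚ-cong (^ₚ-cong e (σ≈τ zero)) (monoSubst-cong d (σ≈τ ∘ suc))

  subst-congʳ : ∀ {n k} (p : Pol n) {σ τ : Fin n → Pol k} → (∀ z → σ z ≈ₚ τ z) → substₚ p σ ≈ₚ substₚ p τ
  subst-congʳ p {σ} {τ} σ≈τ = ≈ₚ-by-pairing λ φ → trans (pairing-subst p σ φ)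
    (trans (pairing-congʳ p (λ d → pairing-cong (monoSubst-cong d σ≈τ) φ)) (sym (pairing-subst p τ φ)))

  subst-≗ʳ : ∀ {n k} (p : Pol n) {σ τ : Fin n → Pol k} → (∀ z → σ z ≡ τ z) → substₚ p σ ≈ₚ substₚ p τ
  subst-≗ʳ p σ≗τ = subst-congʳ p (λ z → ≈ₚ-reflexive (σ≗τ z))

  ^ₚ-+ : ∀ {n} (p : Pol n) a b → p ^ₚ (a ℕ.+ b) ≈ₚ p ^ₚ a *ₚ p ^ₚ b
  ^ₚ-+ p zero    b = ≈ₚ-sym (*ₚ-identityˡ _)
  ^ₚ-+ p (suc a) b = ≈ₚ-trans (*ₚ-congˡ p (^ₚ-+ p a b)) (≈ₚ-sym (*ₚ-assoc p _ _))

  prodP-++ : ∀ {n} (ps qs : List (Pol n)) → prodP F (ps ++ qs) ≈ₚ prodP F ps *ₚ prodP F qs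
  prodP-++ []       qs = ≈ₚ-sym (*ₚ-identityˡ _)
  prodP-++ (p ∷ ps) qs = ≈ₚ-trans (*ₚ-congˡ p (prodP-++ ps qs)) (≈ₚ-sym (*ₚ-assoc p _ _))

  monoSubst-zeros : ∀ {n k} (σ : Fin n → Pol k) → monoSubstₚ zeros σ ≈ₚ 1ₚ
  monoSubst-zeros {zero}  σ = ≈ₚ-refl
  monoSubst-zeros {suc n} σ = ≈ₚ-trans (*ₚ-identityˡ _) (monoSubst-zeros (σ ∘ suc))

  monoSubst-⊕ : ∀ {n k} (d d′ : Exponent n) (σ : Fin n → Pol k) →
    monoSubstₚ (d ⊕ d′) σ ≈ₚ monoSubstₚ d σ *ₚ monoSubstₚ d′ σ
  monoSubst-⊕ []      []        σ = ≈ₚ-sym (*ₚ-identityˡ _)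
  monoSubst-⊕ (a ∷ d) (b ∷ d′) σ = ≈ₚ-trans
    (*ₚ-cong (^ₚ-+ (σ zero) a b) (monoSubst-⊕ d d′ (σ ∘ suc)))
    (*ₚ-interchange (σ zero ^ₚ a) (σ zero ^ₚ b) (monoSubstₚ d (σ ∘ suc)) (monoSubstₚ d′ (σ ∘ suc)))
    where
    open import Algebra.Properties.CommutativeSemigroup
      (CommutativeSemiring.*-commutativeSemigroup (Pol-commutativeSemiring _)) using () renaming (interchange to *ₚ-interchange)

  subst-*ₚ : ∀ {n k} (p q : Pol n) (σ : Fin n → Pol k) → substₚ (p *ₚ q) σ ≈ₚ substₚ p σ *ₚ substₚ q σ
  subst-*ₚ p q σ = ≈ₚ-by-pairing λ φ → begin
    pairing (substₚ (p *ₚ q) σ) φ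
      ≈⟨ trans (pairing-subst (p *ₚ q) σ φ) (pairing-*ₚ p q _) ⟩
    pairing p (λ d₁ → pairing q (λ d₂ → pairing (monoSubstₚ (d₁ ⊕ d₂) σ) φ))
      ≈⟨ pairing-congʳ p (λ d₁ → pairing-congʳ q (λ d₂ →
           trans (pairing-cong (monoSubst-⊕ d₁ d₂ σ) φ) (pairing-*ₚ (monoSubstₚ d₁ σ) (monoSubstₚ d₂ σ) φ))) ⟩
    pairing p (λ d₁ → pairing q (λ d₂ → pairing (monoSubstₚ d₁ σ) (λ e₁ → pairing (monoSubstₚ d₂ σ) (λ e₂ → φ (e₁ ⊕ e₂)))))
      ≈⟨ pairing-congʳ p (λ d₁ → pairing-comm q (monoSubstₚ d₁ σ) _) ⟩
    pairing p (λ d₁ → pairing (monoSubstₚ d₁ σ) (λ e₁ → pairing q (λ d₂ → pairing (monoSubstₚ d₂ σ) (λ e₂ → φ (e₁ ⊕ e₂)))))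
      ≈⟨ trans (pairing-subst p σ _) (pairing-congʳ p (λ d₁ → pairing-congʳ (monoSubstₚ d₁ σ) (λ e₁ → pairing-subst q σ _))) ⟨
    pairing (substₚ p σ) (λ e₁ → pairing (substₚ q σ) (λ e₂ → φ (e₁ ⊕ e₂)))
      ≈⟨ pairing-*ₚ (substₚ p σ) (substₚ q σ) φ ⟨
    pairing (substₚ p σ *ₚ substₚ q σ) φ ∎

  subst-+ₚ : ∀ {n k} (p q : Pol n) (σ : Fin n → Pol k) → substₚ (p +ₚ q) σ ≈ₚ substₚ p σ +ₚ substₚ q σ
  subst-+ₚ p q σ = ≈ₚ-by-pairing λ φ → begin
    pairing (substₚ (p +ₚ q) σ) φ                   ≈⟨ trans (pairing-subst (p +ₚ q) σ φ) (pairing-++ p q _) ⟩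
    pairing p _ + pairing q _                       ≈⟨ +-cong (pairing-subst p σ φ) (pairing-subst q σ φ) ⟨
    pairing (substₚ p σ) φ + pairing (substₚ q σ) φ ≈⟨ pairing-++ (substₚ p σ) (substₚ q σ) φ ⟨
    pairing (substₚ p σ +ₚ substₚ q σ) φ            ∎

  subst-const : ∀ {n k} c (σ : Fin n → Pol k) → substₚ (constₚ c) σ ≈ₚ constₚ c
  subst-const c σ = ≈ₚ-trans (+ₚ-identityʳ _) (≈ₚ-trans (*ₚ-congˡ (constₚ c) (monoSubst-zeros σ)) (*ₚ-identityʳ (constₚ c)))

  subst-^ₚ : ∀ {n k} (p : Pol n) e (σ : Fin n → Pol k) → substₚ (p ^ₚ e) σ ≈ₚ substₚ p σ ^ₚ e
  subst-^ₚ p zero    σ = subst-const 1# σ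
  subst-^ₚ p (suc e) σ = ≈ₚ-trans (subst-*ₚ p (p ^ₚ e) σ) (*ₚ-congˡ (substₚ p σ) (subst-^ₚ p e σ))

  subst-monoSubst : ∀ {n k j} (d : Exponent n) (σ : Fin n → Pol k) (τ : Fin k → Pol j) →
    substₚ (monoSubstₚ d σ) τ ≈ₚ monoSubstₚ d (λ z → substₚ (σ z) τ)
  subst-monoSubst []      σ τ = subst-const 1# τ
  subst-monoSubst (e ∷ d) σ τ = ≈ₚ-trans (subst-*ₚ (σ zero ^ₚ e) _ τ)
    (*ₚ-cong (subst-^ₚ (σ zero) e τ) (subst-monoSubst d (σ ∘ suc) τ))

  subst-subst : ∀ {n k j} (p : Pol n) (σ : Fin n → Pol k) (τ : Fin k → Pol j) →
    substₚ (substₚ p σ) τ ≈ₚ substₚ p (λ z → substₚ (σ z) τ)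
  subst-subst p σ τ = ≈ₚ-by-pairing λ φ → begin
    pairing (substₚ (substₚ p σ) τ) φ
      ≈⟨ trans (pairing-subst (substₚ p σ) τ φ) (pairing-subst p σ _) ⟩
    pairing p (λ d → pairing (monoSubstₚ d σ) (λ d′ → pairing (monoSubstₚ d′ τ) φ))
      ≈⟨ pairing-congʳ p (λ d → sym (pairing-subst (monoSubstₚ d σ) τ φ)) ⟩
    pairing p (λ d → pairing (substₚ (monoSubstₚ d σ) τ) φ)
      ≈⟨ pairing-congʳ p (λ d → pairing-cong (subst-monoSubst d σ τ) φ) ⟩
    pairing p (λ d → pairing (monoSubstₚ d (λ z → substₚ (σ z) τ)) φ)
      ≈⟨ pairing-subst p _ φ ⟨
    pairing (substₚ p (λ z → substₚ (σ z) τ)) φ ∎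

  monoSubst-unitVec : ∀ {n k} (i : Fin n) (σ : Fin n → Pol k) → monoSubstₚ (unitVec F i) σ ≈ₚ σ i
  monoSubst-unitVec zero    σ = ≈ₚ-trans (*ₚ-cong (*ₚ-identityʳ (σ zero)) (monoSubst-zeros (σ ∘ suc))) (*ₚ-identityʳ (σ zero))
  monoSubst-unitVec (suc i) σ = ≈ₚ-trans (*ₚ-identityˡ _) (monoSubst-unitVec i (σ ∘ suc))

  subst-var : ∀ {n k} (i : Fin n) (σ : Fin n → Pol k) → substₚ (varₚ i) σ ≈ₚ σ i
  subst-var i σ = ≈ₚ-trans (+ₚ-identityʳ _) (≈ₚ-trans (*ₚ-identityˡ _) (monoSubst-unitVec i σ))

  module ∑ₚ {k : ℕ} where
    open import Algebra.Properties.CommutativeMonoid.Sum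
      (CommutativeSemiring.+-commutativeMonoid (Pol-commutativeSemiring k)) public
    open import Algebra.Properties.Semiring.Sum
      (CommutativeSemiring.semiring (Pol-commutativeSemiring k)) public using (*-distribˡ-sum)

  module ∑ᶠ = Algebra.Properties.CommutativeMonoid.Sum +-commutativeMonoid

  ∑ₚ : ∀ {n k} → (Fin n → Pol k) → Pol k
  ∑ₚ = ∑ₚ.sum

  sumP-allFin : ∀ {n k} (f : Fin n → Pol k) → sumP F (List.map f (List.allFin n)) ≡ ∑ₚ f
  sumP-allFin f = go f (λ i → i)
    where
    go : ∀ {n k} {A : Set} (f : A → Pol k) (g : Fin n → A) →
      sumP F (List.map f (List.tabulate g)) ≡ ∑ₚ (f ∘ g)
    go {zero}  f g = ≡.refl
    go {suc n} f g = ≡.cong (f (g zero) ++_) (go f (g ∘ suc))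

  coeff-∑ₚ : ∀ {n k} (f : Fin n → Pol k) e → coeffₚ (∑ₚ f) e ≈ ∑ᶠ.sum (λ i → coeffₚ (f i) e)
  coeff-∑ₚ {zero}  f e = refl
  coeff-∑ₚ {suc n} f e = trans (coeff-+ₚ (f zero) _ e) (+-congˡ (coeff-∑ₚ (f ∘ suc) e))

  subst-∑ₚ : ∀ {n k j} (f : Fin n → Pol k) (σ : Fin k → Pol j) → substₚ (∑ₚ f) σ ≈ₚ ∑ₚ (λ i → substₚ (f i) σ)
  subst-∑ₚ {zero}  f σ = ≈ₚ-refl
  subst-∑ₚ {suc n} f σ = ≈ₚ-trans (subst-+ₚ (f zero) _ σ) (+ₚ-cong ≈ₚ-refl (subst-∑ₚ (f ∘ suc) σ))

  ∑ₚ-cong : ∀ {n k} {f g : Fin n → Pol k} → (∀ i → f i ≈ₚ g i) → ∑ₚ f ≈ₚ ∑ₚ g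
  ∑ₚ-cong = ∑ₚ.sum-cong-≋

  ∑ᶠ-zero : ∀ {n} {f : Fin n → Carrier} → (∀ i → f i ≈ 0#) → ∑ᶠ.sum f ≈ 0#
  ∑ᶠ-zero {n} f≈0 = trans (∑ᶠ.sum-cong-≋ f≈0) (∑ᶠ.sum-replicate-zero n)

  ∑ᶠ-single : ∀ {n} (f : Fin n → Carrier) i → (∀ j → j ≢ i → f j ≈ 0#) → ∑ᶠ.sum f ≈ f i
  ∑ᶠ-single f zero    f≈0 =
    trans (+-congˡ (∑ᶠ-zero (λ j → f≈0 (suc j) (λ ())))) (+-identityʳ _)
  ∑ᶠ-single f (suc i) f≈0 = trans (+-congʳ (f≈0 zero (λ ())))
    (trans (+-identityˡ _) (∑ᶠ-single (f ∘ suc) i (λ j j≢i → f≈0 (suc j) (j≢i ∘ FinP.suc-injective))))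

  ∑ᶠ-const : ∀ n c → ∑ᶠ.sum {n} (λ _ → c) ≈ (_×1 F n) * c
  ∑ᶠ-const zero    c = sym (zeroˡ c)
  ∑ᶠ-const (suc n) c = trans (+-cong (sym (*-identityˡ c)) (∑ᶠ-const n c)) (sym (distribʳ c 1# _))

  monomialₚ : ∀ {n} → Exponent n → Pol n
  monomialₚ v = term 1# v ∷ []

  pairing-monomial : ∀ {n} (v : Exponent n) φ → pairing (monomialₚ v) φ ≈ φ v
  pairing-monomial v φ = trans (+-identityʳ _) (*-identityˡ _)

  coeff-monomial : ∀ {n} (v e : Exponent n) → coeffₚ (monomialₚ v) e ≈ δ e v
  coeff-monomial v e = trans (coeff≈pairing-δ (monomialₚ v) e) (pairing-monomial v (δ e))

  monomial-* : ∀ {n} (u v : Exponent n) → monomialₚ u *ₚ monomialₚ v ≈ₚ monomialₚ (u ⊕ v)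
  monomial-* u v = ≈ₚ-by-pairing λ φ → begin
    pairing (monomialₚ u *ₚ monomialₚ v) φ ≈⟨ pairing-*ₚ (monomialₚ u) (monomialₚ v) φ ⟩
    pairing (monomialₚ u) (λ d → pairing (monomialₚ v) (λ d′ → φ (d ⊕ d′)))
                                          ≈⟨ pairing-monomial u (λ d → pairing (monomialₚ v) (λ d′ → φ (d ⊕ d′))) ⟩
    pairing (monomialₚ v) (λ d′ → φ (u ⊕ d′))
                                          ≈⟨ pairing-monomial v (λ d′ → φ (u ⊕ d′)) ⟩
    φ (u ⊕ v)                             ≈⟨ pairing-monomial (u ⊕ v) φ ⟨
    pairing (monomialₚ (u ⊕ v)) φ         ∎

  coeff-const : ∀ {n} c (e : Exponent n) → coeffₚ (constₚ c) e ≈ c * δ e zeros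
  coeff-const c e = trans (coeff≈pairing-δ (constₚ c) e) (pairing-const c (δ e))

  0ₚ≉1ₚ : ∀ {n} → ¬ (0ₚ {n} ≈ₚ 1ₚ)
  0ₚ≉1ₚ {n} (mk≈ 0≈1) = 1≉0 (sym (trans (0≈1 zeros) (trans (coeff-const {n} 1# zeros) (trans (*-congˡ (δ-refl (zeros {n}))) (*-identityʳ 1#)))))

  degree0⇒const : ∀ {n} (P : Pol n) → DegreeAtMost F 0 P → P ≈ₚ constₚ (coeffₚ P zeros)
  degree0⇒const {n} P deg≤0 = mk≈ λ e → by-degree e (Vec.sum e ℕP.≟ 0)
    where
    by-degree : ∀ e → Dec (Vec.sum e ≡ 0) → coeffₚ P e ≈ coeffₚ (constₚ (coeffₚ P zeros)) e
    by-degree e (yes e≡0) rewrite sum≡0⇒zeros e e≡0 =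
      sym (trans (coeff-const {n} _ zeros) (trans (*-congˡ (δ-refl (zeros {n}))) (*-identityʳ _)))
    by-degree e (no e≢0) = trans (deg≤0 e (ℕP.n≢0⇒n>0 e≢0)) (sym (trans (coeff-const _ e)
      (trans (*-congˡ (δ-≢ {e = e} {d = zeros} (λ 0≡e → e≢0 (≡.trans (≡.cong Vec.sum (≡.sym 0≡e)) (sum-zeros n))))) (zeroʳ _))))

module Renaming {a ℓ : Level} (F : Field a ℓ) where
  open Field F hiding (zero)
  open Polynomials F
  open Monomials using (sum-zeros)

  power : ∀ {n} → Fin n → ℕ → Exponent n
  power i zero    = zeros
  power i (suc a) = unitVec F i ⊕ power i a

  pushExp : ∀ {k n} → (Fin k → Fin n) → Exponent k → Exponent n
  pushExp ρ []      = zeros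
  pushExp ρ (a ∷ d) = power (ρ zero) a ⊕ pushExp (ρ ∘ suc) d

  reindex : ∀ {n k} → (Fin k → Fin n) → Exponent n → Exponent k
  reindex ρ e = Vec.tabulate (lookup e ∘ ρ)

  lookup-zeros : ∀ {n} (w : Fin n) → lookup (zeros {n}) w ≡ 0
  lookup-zeros w = VecP.lookup-replicate w 0

  lookup-⊕ : ∀ {n} (u v : Exponent n) w → lookup (u ⊕ v) w ≡ lookup u w ℕ.+ lookup v w
  lookup-⊕ u v w = VecP.lookup-zipWith ℕ._+_ w u v

  lookup-unitVec-≡ : ∀ {n} (i : Fin n) → lookup (unitVec F i) i ≡ 1
  lookup-unitVec-≡ zero    = ≡.refl
  lookup-unitVec-≡ (suc i) = lookup-unitVec-≡ i

  lookup-unitVec-≢ : ∀ {n} {i w : Fin n} → i ≢ w → lookup (unitVec F i) w ≡ 0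
  lookup-unitVec-≢ {i = zero}  {zero}  i≢w = contradiction ≡.refl i≢w
  lookup-unitVec-≢ {i = zero}  {suc w} i≢w = lookup-zeros w
  lookup-unitVec-≢ {i = suc i} {zero}  i≢w = ≡.refl
  lookup-unitVec-≢ {i = suc i} {suc w} i≢w = lookup-unitVec-≢ (i≢w ∘ ≡.cong suc)

  lookup-power-≡ : ∀ {n} (i : Fin n) a → lookup (power i a) i ≡ a
  lookup-power-≡ i zero    = lookup-zeros i
  lookup-power-≡ i (suc a) =
    ≡.trans (lookup-⊕ (unitVec F i) (power i a) i) (≡.cong₂ ℕ._+_ (lookup-unitVec-≡ i) (lookup-power-≡ i a))

  lookup-power-≢ : ∀ {n} {i w : Fin n} a → i ≢ w → lookup (power i a) w ≡ 0
  lookup-power-≢ {w = w} zero    i≢w = lookup-zeros w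
  lookup-power-≢ {i = i} {w} (suc a) i≢w =
    ≡.trans (lookup-⊕ (unitVec F i) (power i a) w) (≡.cong₂ ℕ._+_ (lookup-unitVec-≢ i≢w) (lookup-power-≢ a i≢w))

  lookup-pushExp-∉ : ∀ {k n} (ρ : Fin k → Fin n) d w → (∀ z → ρ z ≢ w) → lookup (pushExp ρ d) w ≡ 0
  lookup-pushExp-∉ ρ []      w w∉ρ = lookup-zeros w
  lookup-pushExp-∉ ρ (a ∷ d) w w∉ρ = ≡.trans (lookup-⊕ (power (ρ zero) a) _ w)
    (≡.cong₂ ℕ._+_ (lookup-power-≢ a (w∉ρ zero)) (lookup-pushExp-∉ (ρ ∘ suc) d w (w∉ρ ∘ suc)))

  lookup-pushExp-∈ : ∀ {k n} {ρ : Fin k → Fin n} → Injective _≡_ _≡_ ρ → ∀ d z → lookup (pushExp ρ d) (ρ z) ≡ lookup d z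
  lookup-pushExp-∈ {ρ = ρ} ρ-inj (a ∷ d) zero = begin
    lookup (power (ρ zero) a ⊕ pushExp (ρ ∘ suc) d) (ρ zero)                   ≡⟨ lookup-⊕ (power (ρ zero) a) _ (ρ zero) ⟩
    lookup (power (ρ zero) a) (ρ zero) ℕ.+ lookup (pushExp (ρ ∘ suc) d) (ρ zero)
      ≡⟨ ≡.cong₂ ℕ._+_ (lookup-power-≡ (ρ zero) a) (lookup-pushExp-∉ (ρ ∘ suc) d (ρ zero) (λ z ρz≡ρ0 → suc≢zero (ρ-inj ρz≡ρ0))) ⟩
    a ℕ.+ 0                                                                     ≡⟨ ℕP.+-identityʳ a ⟩
    a                                                                           ∎
    where
    open ≡.≡-Reasoning
    suc≢zero : ∀ {k} {z : Fin k} → suc z ≢ zero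
    suc≢zero ()
  lookup-pushExp-∈ {ρ = ρ} ρ-inj (a ∷ d) (suc z) = ≡.trans (lookup-⊕ (power (ρ zero) a) _ (ρ (suc z)))
    (≡.cong₂ ℕ._+_ (lookup-power-≢ a (zero≢suc ∘ ρ-inj)) (lookup-pushExp-∈ (FinP.suc-injective ∘ ρ-inj) d z))
    where
    zero≢suc : zero ≢ suc z
    zero≢suc ()

  Vec-ext : ∀ {A : Set} {n} {xs ys : Vec A n} → (∀ i → lookup xs i ≡ lookup ys i) → xs ≡ ys
  Vec-ext {xs = xs} {ys} xs≗ys =
    ≡.trans (≡.sym (VecP.tabulate∘lookup xs)) (≡.trans (VecP.tabulate-cong xs≗ys) (VecP.tabulate∘lookup ys))

  lookup-reindex : ∀ {n k} (ρ : Fin k → Fin n) e z → lookup (reindex ρ e) z ≡ lookup e (ρ z)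
  lookup-reindex ρ e = VecP.lookup∘tabulate (lookup e ∘ ρ)

  reindex-∘ : ∀ {n} (f g : Fin n → Fin n) e → reindex f (reindex g e) ≡ reindex (g ∘ f) e
  reindex-∘ f g e = VecP.tabulate-cong (lookup-reindex g e ∘ f)

  reindex-id : ∀ {n} {f : Fin n → Fin n} → (∀ z → f z ≡ z) → ∀ e → reindex f e ≡ e
  reindex-id f≗id e = ≡.trans (VecP.tabulate-cong (≡.cong (lookup e) ∘ f≗id)) (VecP.tabulate∘lookup e)

  reindex-inverse : ∀ {n} (π : Permutation′ n) e → reindex (π ⟨$⟩ʳ_) (reindex (π ⟨$⟩ˡ_) e) ≡ e
  reindex-inverse π e = ≡.trans (reindex-∘ _ _ e) (reindex-id (λ z → Perm.inverseˡ π) e)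

  pushExp-permutation : ∀ {n} (π : Permutation′ n) d → pushExp (π ⟨$⟩ʳ_) d ≡ reindex (π ⟨$⟩ˡ_) d
  pushExp-permutation π d = Vec-ext λ w → begin
    lookup (pushExp (π ⟨$⟩ʳ_) d) w                   ≡⟨ ≡.cong (lookup (pushExp (π ⟨$⟩ʳ_) d)) (Perm.inverseʳ π) ⟨
    lookup (pushExp (π ⟨$⟩ʳ_) d) (π ⟨$⟩ʳ (π ⟨$⟩ˡ w)) ≡⟨ lookup-pushExp-∈ (Injection.injective (↔⇒↣ π)) d (π ⟨$⟩ˡ w) ⟩
    lookup d (π ⟨$⟩ˡ w)                              ≡⟨ lookup-reindex (π ⟨$⟩ˡ_) d w ⟨
    lookup (reindex (π ⟨$⟩ˡ_) d) w                   ∎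
    where open ≡.≡-Reasoning

  δ-pushExp : ∀ {n} (π : Permutation′ n) d e → δ e (pushExp (π ⟨$⟩ʳ_) d) ≈ δ (reindex (π ⟨$⟩ʳ_) e) d
  δ-pushExp π d e with pushExp (π ⟨$⟩ʳ_) d ≟ᵉ e | d ≟ᵉ reindex (π ⟨$⟩ʳ_) e
  ... | yes _ | yes _ = refl
  ... | no  _ | no  _ = refl
  ... | yes πd≡e | no d≢πe = contradiction (≡.trans (≡.sym (reindex-inverse π d))
                                      (≡.cong (reindex (π ⟨$⟩ʳ_)) (≡.trans (≡.sym (pushExp-permutation π d)) πd≡e))) d≢πe
  ... | no πd≢e | yes d≡πe = contradiction (≡.trans (pushExp-permutation π d)
                                      (≡.trans (≡.cong (reindex (π ⟨$⟩ˡ_)) d≡πe) (reindex-inverse (Perm.flip π) e))) πd≢e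

  var^ₚ : ∀ {n} (i : Fin n) a → varₚ i ^ₚ a ≈ₚ monomialₚ (power i a)
  var^ₚ i zero    = ≈ₚ-refl
  var^ₚ i (suc a) = ≈ₚ-trans (*ₚ-congˡ (varₚ i) (var^ₚ i a)) (monomial-* (unitVec F i) (power i a))

  monoSubst-var : ∀ {k n} (ρ : Fin k → Fin n) d → monoSubstₚ d (varₚ ∘ ρ) ≈ₚ monomialₚ (pushExp ρ d)
  monoSubst-var ρ []      = ≈ₚ-refl
  monoSubst-var ρ (a ∷ d) = ≈ₚ-trans (*ₚ-cong (var^ₚ (ρ zero) a) (monoSubst-var (ρ ∘ suc) d)) (monomial-* _ _)

  monoSubst-varₚ : ∀ {n} (d : Exponent n) → monoSubstₚ d varₚ ≈ₚ monomialₚ d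
  monoSubst-varₚ d = ≈ₚ-trans (monoSubst-var id d)
    (≈ₚ-reflexive (≡.cong monomialₚ (≡.trans (pushExp-permutation Perm.id d) (reindex-id (λ _ → ≡.refl) d))))

  coeff-rename : ∀ {n} (π : Permutation′ n) (p : Pol n) e →
    coeffₚ (substₚ p (varₚ ∘ (π ⟨$⟩ʳ_))) e ≈ coeffₚ p (reindex (π ⟨$⟩ʳ_) e)
  coeff-rename π p e = begin
    coeffₚ (substₚ p σ) e                          ≈⟨ coeff≈pairing-δ (substₚ p σ) e ⟩
    pairing (substₚ p σ) (δ e)                     ≈⟨ pairing-subst p σ (δ e) ⟩
    pairing p (λ d → pairing (monoSubstₚ d σ) (δ e)) ≈⟨ pairing-congʳ p monomial-δ ⟩
    pairing p (δ (reindex (π ⟨$⟩ʳ_) e))            ≈⟨ coeff≈pairing-δ p _ ⟨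
    coeffₚ p (reindex (π ⟨$⟩ʳ_) e)                 ∎
    where
    open import Relation.Binary.Reasoning.Setoid setoid
    σ = varₚ ∘ (π ⟨$⟩ʳ_)
    monomial-δ : ∀ d → pairing (monoSubstₚ d σ) (δ e) ≈ δ (reindex (π ⟨$⟩ʳ_) e) d
    monomial-δ d = trans (pairing-cong (monoSubst-var (π ⟨$⟩ʳ_) d) (δ e))
                         (trans (pairing-monomial (pushExp (π ⟨$⟩ʳ_) d) (δ e)) (δ-pushExp π d e))

  subst-var-id : ∀ {n} (p : Pol n) → substₚ p varₚ ≈ₚ p
  subst-var-id p = mk≈ λ e → trans (coeff-rename Perm.id p e) (reflexive (≡.cong (coeffₚ p) (reindex-id (λ _ → ≡.refl) e)))

  sum-⊕ : ∀ {n} (u v : Exponent n) → Vec.sum (u ⊕ v) ≡ Vec.sum u ℕ.+ Vec.sum v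
  sum-⊕ []      []      = ≡.refl
  sum-⊕ (x ∷ u) (y ∷ v) = ≡.trans (≡.cong (x ℕ.+ y ℕ.+_) (sum-⊕ u v)) (interchange x y (Vec.sum u) (Vec.sum v))
    where open import Algebra.Properties.CommutativeSemigroup ℕP.+-commutativeSemigroup using (interchange)

  sum-unitVec : ∀ {n} (i : Fin n) → Vec.sum (unitVec F i) ≡ 1
  sum-unitVec {suc n} zero    = ≡.cong suc (sum-zeros n)
  sum-unitVec         (suc i) = sum-unitVec i

  sum-power : ∀ {n} (i : Fin n) a → Vec.sum (power i a) ≡ a
  sum-power {n} i zero    = sum-zeros n
  sum-power     i (suc a) = ≡.trans (sum-⊕ (unitVec F i) (power i a)) (≡.cong₂ ℕ._+_ (sum-unitVec i) (sum-power i a))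

  sum-pushExp : ∀ {k n} (ρ : Fin k → Fin n) d → Vec.sum (pushExp ρ d) ≡ Vec.sum d
  sum-pushExp {n = n} ρ []      = sum-zeros n
  sum-pushExp         ρ (a ∷ d) = ≡.trans (sum-⊕ (power (ρ zero) a) _) (≡.cong₂ ℕ._+_ (sum-power (ρ zero) a) (sum-pushExp (ρ ∘ suc) d))

  sum-reindex : ∀ {n} (π : Permutation′ n) d → Vec.sum (reindex (π ⟨$⟩ʳ_) d) ≡ Vec.sum d
  sum-reindex π d = ≡.trans (≡.cong Vec.sum (≡.sym (pushExp-permutation (Perm.flip π) d))) (sum-pushExp _ d)

module Characteristic {a ℓ : Level} (F : Field a ℓ) where
  open Field F hiding (zero)
  open import Relation.Binary.Reasoning.Setoid setoid

  infix 8 _·1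
  _·1 : ℕ → Carrier
  _·1 = _×1 F

  ·1-+ : ∀ m n → (m ℕ.+ n) ·1 ≈ m ·1 + n ·1
  ·1-+ zero    n = sym (+-identityˡ _)
  ·1-+ (suc m) n = trans (+-congˡ (·1-+ m n)) (sym (+-assoc _ _ _))

  ·1-* : ∀ m n → (m ℕ.* n) ·1 ≈ m ·1 * n ·1
  ·1-* zero    n = sym (zeroˡ _)
  ·1-* (suc m) n = trans (·1-+ n (m ℕ.* n)) (trans (+-cong (sym (*-identityˡ _)) (·1-* m n)) (sym (distribʳ _ _ _)))

  -- Writing n = r + q p with r < p, we get r·1 = n·1 - q (p·1) = 0, so minimality of p forces r = 0.
  char∣ : ∀ {p} → HasChar F p → ∀ n → n ·1 ≈ 0# → p ∣ n
  char∣ {p} (0<p , p·1≈0 , p-minimal) n n·1≈0 = divides-by-remainder (n % p) ≡.refl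
    where
    instance
      p≢0 : ℕ.NonZero p
      p≢0 = ℕ.>-nonZero 0<p
    r·1≈0 : (n % p) ·1 ≈ 0#
    r·1≈0 = begin
      (n % p) ·1                    ≈⟨ +-identityʳ _ ⟨
      (n % p) ·1 + 0#               ≈⟨ +-congˡ (trans (·1-* (n / p) p) (trans (*-congˡ p·1≈0) (zeroʳ _))) ⟨
      (n % p) ·1 + (n / p ℕ.* p) ·1 ≈⟨ ·1-+ (n % p) (n / p ℕ.* p) ⟨
      (n % p ℕ.+ n / p ℕ.* p) ·1    ≈⟨ reflexive (≡.cong _·1 (m≡m%n+[m/n]*n n p)) ⟨
      n ·1                          ≈⟨ n·1≈0 ⟩
      0#                            ∎
    divides-by-remainder : ∀ r → n % p ≡ r → p ∣ n
    divides-by-remainder zero    r≡0 = divides (n / p) (≡.trans (m≡m%n+[m/n]*n n p) (≡.cong (ℕ._+ n / p ℕ.* p) r≡0))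
    divides-by-remainder (suc r) r≡  = contradiction (≡.subst (λ x → x ·1 ≈ 0#) r≡ r·1≈0)
      (p-minimal (suc r) (s≤s z≤n) (≡.subst (_< p) r≡ (m%n<n n p)))

  ·1-invertible : ∀ n → CharCondition F (suc n) → Σ Carrier λ y → (suc n) ·1 * y ≈ 1#
  ·1-invertible n cc = inverse ((suc n) ·1) (·1≉0 cc)
    where
    ·1≉0 : CharCondition F (suc n) → ¬ ((suc n) ·1 ≈ 0#)
    ·1≉0 (inj₁ char≡0)                       = char≡0 n
    ·1≉0 (inj₂ (p , char≡p@(_ , p·1≈0 , _) , coprime)) n·1≈0 =
      1≉0 (trans (sym (+-identityʳ 1#)) (≡.subst (λ x → x ·1 ≈ 0#) p≡1 p·1≈0))
      where
      p≡1 : p ≡ 1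
      p≡1 = coprime (∣-refl , char∣ char≡p (suc n) n·1≈0)

module Layers {a ℓ : Level} (F : Field a ℓ) where
  open FinSum

  shiftGate : ∀ {nZ m} L → GateDef F nZ m → GateDef F nZ (L ℕ.+ m)
  shiftGate L (inVar z)   = inVar z
  shiftGate L (inConst x) = inConst x
  shiftGate L (op o cs)   = op o (List.map (L ↑ʳ_) cs)

  -- Gate j of the layer becomes gate j ↑ˡ m; the old gate i becomes L ↑ʳ i.
  addLayer : ∀ {nZ m L} → Circ F nZ m → (Fin L → GateDef F nZ m) → Circ F nZ (L ℕ.+ m)
  addLayer {L = zero}  c ds = c
  addLayer {L = suc L} c ds = addLayer c (ds ∘ suc) ▷ shiftGate L (ds zero)

  gateLabel : ∀ {nZ m} → GateDef F nZ m → Label F nZ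
  gateLabel (inVar z)   = lvar z
  gateLabel (inConst x) = lconst x
  gateLabel (op o _)    = lop o

  gateChildren : ∀ {nZ m} → GateDef F nZ m → List (Fin m)
  gateChildren (inVar z)   = []
  gateChildren (inConst x) = []
  gateChildren (op o cs)   = cs

  label-▷-suc : ∀ {nZ n} (c : Circ F nZ n) g j → label F (c ▷ g) (suc j) ≡ label F c j
  label-▷-suc c (inVar z)   j = ≡.refl
  label-▷-suc c (inConst x) j = ≡.refl
  label-▷-suc c (op o cs)   j = ≡.refl

  children-▷-suc : ∀ {nZ n} (c : Circ F nZ n) g j → children F (c ▷ g) (suc j) ≡ List.map suc (children F c j)
  children-▷-suc c (inVar z)   j = ≡.refl
  children-▷-suc c (inConst x) j = ≡.refl
  children-▷-suc c (op o cs)   j = ≡.refl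

  module _ {nZ m : ℕ} where
    label-↑ˡ : ∀ {L} (c : Circ F nZ m) (ds : Fin L → GateDef F nZ m) j →
      label F (addLayer c ds) (j ↑ˡ m) ≡ gateLabel (ds j)
    label-↑ˡ c ds zero with ds zero
    ... | inVar z   = ≡.refl
    ... | inConst x = ≡.refl
    ... | op o cs   = ≡.refl
    label-↑ˡ c ds (suc j) = ≡.trans (label-▷-suc (addLayer c (ds ∘ suc)) (shiftGate _ (ds zero)) (j ↑ˡ m)) (label-↑ˡ c (ds ∘ suc) j)

    label-↑ʳ : ∀ {L} (c : Circ F nZ m) (ds : Fin L → GateDef F nZ m) i →
      label F (addLayer c ds) (L ↑ʳ i) ≡ label F c i
    label-↑ʳ {zero}  c ds i = ≡.refl
    label-↑ʳ {suc L} c ds i = ≡.trans (label-▷-suc (addLayer c (ds ∘ suc)) (shiftGate _ (ds zero)) (L ↑ʳ i)) (label-↑ʳ c (ds ∘ suc) i)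

    children-↑ˡ : ∀ {L} (c : Circ F nZ m) (ds : Fin L → GateDef F nZ m) j →
      children F (addLayer c ds) (j ↑ˡ m) ≡ List.map (L ↑ʳ_) (gateChildren (ds j))
    children-↑ˡ c ds zero with ds zero
    ... | inVar z   = ≡.refl
    ... | inConst x = ≡.refl
    ... | op o cs   = ≡.sym (ListP.map-∘ cs)
    children-↑ˡ c ds (suc j) = ≡.trans (children-▷-suc (addLayer c (ds ∘ suc)) (shiftGate _ (ds zero)) (j ↑ˡ m))
      (≡.trans (≡.cong (List.map suc) (children-↑ˡ c (ds ∘ suc) j)) (≡.sym (ListP.map-∘ (gateChildren (ds (suc j))))))

    children-↑ʳ : ∀ {L} (c : Circ F nZ m) (ds : Fin L → GateDef F nZ m) i →
      children F (addLayer c ds) (L ↑ʳ i) ≡ List.map (L ↑ʳ_) (children F c i)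
    children-↑ʳ {zero}  c ds i = ≡.sym (ListP.map-id (children F c i))
    children-↑ʳ {suc L} c ds i = ≡.trans (children-▷-suc (addLayer c (ds ∘ suc)) (shiftGate _ (ds zero)) (L ↑ʳ i))
      (≡.trans (≡.cong (List.map suc) (children-↑ʳ c (ds ∘ suc) i)) (≡.sym (ListP.map-∘ (children F c i))))

    value-↑ʳ : ∀ {L} (c : Circ F nZ m) (ds : Fin L → GateDef F nZ m) i →
      gateValue F (addLayer c ds) (L ↑ʳ i) ≡ gateValue F c i
    value-↑ʳ {zero}  c ds i = ≡.refl
    value-↑ʳ {suc L} c ds i = value-↑ʳ c (ds ∘ suc) i

    values-↑ʳ : ∀ {L} (c : Circ F nZ m) (ds : Fin L → GateDef F nZ m) cs →
      List.map (lookup (values F (addLayer c ds))) (List.map (L ↑ʳ_) cs) ≡ List.map (lookup (values F c)) cs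
    values-↑ʳ c ds cs = ≡.trans (≡.sym (ListP.map-∘ cs)) (ListP.map-cong (value-↑ʳ c ds) cs)

    value-↑ˡ : ∀ {L} (c : Circ F nZ m) (ds : Fin L → GateDef F nZ m) j →
      gateValue F (addLayer c ds) (j ↑ˡ m) ≡ evalGate F (values F c) (ds j)
    value-↑ˡ c ds zero with ds zero
    ... | inVar z     = ≡.refl
    ... | inConst x   = ≡.refl
    ... | op plus cs  = ≡.cong (sumP F) (values-↑ʳ c (ds ∘ suc) cs)
    ... | op times cs = ≡.cong (prodP F) (values-↑ʳ c (ds ∘ suc) cs)
    value-↑ˡ c ds (suc j) = value-↑ˡ c (ds ∘ suc) j

  PreservesEdges : ∀ {nZ n} → Circ F nZ n → (Fin n → Fin n) → Set
  PreservesEdges {n = n} c σ = ∀ (u v : Fin n) →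
    (u ∈ children F c v → σ u ∈ children F c (σ v)) × (σ u ∈ children F c (σ v) → u ∈ children F c v)

  module _ {nZ m L : ℕ} (c : Circ F nZ m) (ds : Fin L → GateDef F nZ m) where
    private
      c′ = addLayer c ds

    ↑ˡ-childless : ∀ j v → j ↑ˡ m ∉ children F c′ v
    ↑ˡ-childless j = ↑-elim _
      (λ j′ → ≡.subst (λ cs → j ↑ˡ m ∉ cs) (≡.sym (children-↑ˡ c ds j′)) (↑ˡ∉map-↑ʳ j))
      (λ i′ → ≡.subst (λ cs → j ↑ˡ m ∉ cs) (≡.sym (children-↑ʳ c ds i′)) (↑ˡ∉map-↑ʳ j))

    PreservesEdges-addLayer : ∀ {σL : Fin L → Fin L} {σm : Fin m → Fin m} → PreservesEdges c σm →
      (∀ i j → (i ∈ gateChildren (ds j) → σm i ∈ gateChildren (ds (σL j))) ×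
               (σm i ∈ gateChildren (ds (σL j)) → i ∈ gateChildren (ds j))) →
      PreservesEdges c′ (blockMap σL σm)
    PreservesEdges-addLayer {σL} {σm} old-edges new-edges = ↑-elim _ new-child old-child
      where
      σ = blockMap σL σm
      new-child : ∀ j v → _
      new-child j v = (λ j∈ → ⊥-elim (↑ˡ-childless j v j∈))
                    , (λ σj∈ → ⊥-elim (↑ˡ-childless (σL j) (σ v) (≡.subst (_∈ _) (blockMap-↑ˡ σL σm j) σj∈)))
      via : ∀ i {v w xs ys} → children F c′ v ≡ List.map (L ↑ʳ_) xs → children F c′ w ≡ List.map (L ↑ʳ_) ys →
        σ v ≡ w → (i ∈ xs → σm i ∈ ys) × (σm i ∈ ys → i ∈ xs) →
        (L ↑ʳ i ∈ children F c′ v → σ (L ↑ʳ i) ∈ children F c′ (σ v)) ×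
        (σ (L ↑ʳ i) ∈ children F c′ (σ v) → L ↑ʳ i ∈ children F c′ v)
      via i children-v children-w σv≡w (to , from) rewrite children-v | σv≡w | children-w | blockMap-↑ʳ σL σm i =
          ∈P.∈-map⁺ _ ∘ to ∘ ∈-map-injective⁻ (FinP.↑ʳ-injective L _ _)
        , ∈P.∈-map⁺ _ ∘ from ∘ ∈-map-injective⁻ (FinP.↑ʳ-injective L _ _)
      old-child : ∀ i v → _
      old-child i = ↑-elim _
        (λ j → via i (children-↑ˡ c ds j) (children-↑ˡ c ds (σL j)) (blockMap-↑ˡ σL σm j) (new-edges i j))
        (λ i′ → via i (children-↑ʳ c ds i′) (children-↑ʳ c ds (σm i′)) (blockMap-↑ʳ σL σm i′) (old-edges i i′))

    labels-addLayer : ∀ {r} (R : Label F nZ → Label F nZ → Set r) {σL : Fin L → Fin L} {σm : Fin m → Fin m} →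
      (∀ i → R (label F c i) (label F c (σm i))) → (∀ j → R (gateLabel (ds j)) (gateLabel (ds (σL j)))) →
      ∀ u → R (label F c′ u) (label F c′ (blockMap σL σm u))
    labels-addLayer R {σL} {σm} old-labels new-labels = ↑-elim _
      (λ j → ≡.subst₂ R (≡.sym (label-↑ˡ c ds j))
               (≡.sym (≡.trans (≡.cong (label F c′) (blockMap-↑ˡ σL σm j)) (label-↑ˡ c ds (σL j)))) (new-labels j))
      (λ i → ≡.subst₂ R (≡.sym (label-↑ʳ c ds i))
               (≡.sym (≡.trans (≡.cong (label F c′) (blockMap-↑ʳ σL σm i)) (label-↑ʳ c ds (σm i)))) (old-labels i))

  OpsHaveChildren : ∀ {nZ n} → Circ F nZ n → Set a
  OpsHaveChildren {n = n} c = ∀ (i : Fin n) o → label F c i ≡ lop o → Σ (Fin n) λ j → j ∈ children F c i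

  ChildrenUnique : ∀ {nZ n} → Circ F nZ n → Set
  ChildrenUnique {n = n} c = ∀ (i : Fin n) → Unique (children F c i)

  HasParent : ∀ {nZ n} → Circ F nZ n → Fin n → Set
  HasParent {n = n} c u = Σ (Fin n) λ v → u ∈ children F c v

  module _ {nZ m L : ℕ} (c : Circ F nZ m) (ds : Fin L → GateDef F nZ m) where
    private
      c′ = addLayer c ds
      ∈-↑ʳ : ∀ {i : Fin m} {v cs} → children F c′ v ≡ List.map (L ↑ʳ_) cs → i ∈ cs → L ↑ʳ i ∈ children F c′ v
      ∈-↑ʳ children-v i∈ = ≡.subst (_ ∈_) (≡.sym children-v) (∈P.∈-map⁺ _ i∈)

    OpsHaveChildren-addLayer : OpsHaveChildren c →
      (∀ j o → gateLabel (ds j) ≡ lop o → Σ (Fin m) λ i → i ∈ gateChildren (ds j)) → OpsHaveChildren c′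
    OpsHaveChildren-addLayer old new = ↑-elim _
      (λ j o label≡ → let i , i∈ = new j o (≡.trans (≡.sym (label-↑ˡ c ds j)) label≡)
                      in L ↑ʳ i , ∈-↑ʳ (children-↑ˡ c ds j) i∈)
      (λ i′ o label≡ → let i , i∈ = old i′ o (≡.trans (≡.sym (label-↑ʳ c ds i′)) label≡)
                       in L ↑ʳ i , ∈-↑ʳ (children-↑ʳ c ds i′) i∈)

    ChildrenUnique-addLayer : ChildrenUnique c → (∀ j → Unique (gateChildren (ds j))) → ChildrenUnique c′
    ChildrenUnique-addLayer old new = ↑-elim _
      (λ j → ≡.subst Unique (≡.sym (children-↑ˡ c ds j)) (map-↑ʳ (new j)))
      (λ i → ≡.subst Unique (≡.sym (children-↑ʳ c ds i)) (map-↑ʳ (old i)))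
      where
      map-↑ʳ : ∀ {cs : List (Fin m)} → Unique cs → Unique (List.map (L ↑ʳ_) cs)
      map-↑ʳ = UniqueP.map⁺ (FinP.↑ʳ-injective L _ _)

    HasParent-↑ʳ : ∀ i → HasParent c i → HasParent c′ (L ↑ʳ i)
    HasParent-↑ʳ i (v , i∈) = L ↑ʳ v , ∈-↑ʳ (children-↑ʳ c ds v) i∈

    HasParent-layer : ∀ i j → i ∈ gateChildren (ds j) → HasParent c′ (L ↑ʳ i)
    HasParent-layer i j i∈ = j ↑ˡ m , ∈-↑ʳ (children-↑ˡ c ds j) i∈

module MonomialCircuit {a ℓ : Level} (F : Field a ℓ) (N K : ℕ) where
  open Field F hiding (zero)
  open Polynomials F
  open Renaming F
  open Layers F
  open FinSum
  open Monomials
  open BelowFin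

  M : ℕ
  M = length (monomials N K)

  E : Fin M → Exponent N
  E = List.lookup (monomials N K)

  E-injective : ∀ {i j} → E i ≡ E j → i ≡ j
  E-injective = lookup-injective _ (monomials-unique N K)

  sum-E≤K : ∀ i → Vec.sum (E i) ≤ K
  sum-E≤K i = monomials-sound N K (E i) (∈P.∈-lookup i)

  indexOf : ∀ e → Vec.sum e ≤ K → Fin M
  indexOf e e≤K = Any.index (monomials-complete N K e e≤K)

  E-indexOf : ∀ e (e≤K : Vec.sum e ≤ K) → E (indexOf e e≤K) ≡ e
  E-indexOf e e≤K = lookup-index (monomials-complete N K e e≤K)

  -- Gate combine z r is the (r+1)-st copy of x_z; x^e uses the first e_z copies of each x_z.
  copiesOf : ∀ {N′} → Exponent N′ → List (Fin (N′ ℕ.* K))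
  copiesOf []      = []
  copiesOf {suc N′} (a ∷ e) = List.map (_↑ˡ N′ ℕ.* K) (below a K) ++ List.map (K ↑ʳ_) (copiesOf e)

  ∈-copiesOf⁺ : ∀ {N′} (e : Exponent N′) z r → toℕ r < lookup e z → combine z r ∈ copiesOf e
  ∈-copiesOf⁺ (a ∷ e) zero    r r<a = ∈P.∈-++⁺ˡ (∈P.∈-map⁺ _ (∈-below⁺ r r<a))
  ∈-copiesOf⁺ (a ∷ e) (suc z) r r<e = ∈P.∈-++⁺ʳ _ (∈P.∈-map⁺ _ (∈-copiesOf⁺ e z r r<e))

  ∈-copiesOf⁻ : ∀ {N′} (e : Exponent N′) z r → combine z r ∈ copiesOf e → toℕ r < lookup e z
  ∈-copiesOf⁻ {suc N′} (a ∷ e) zero r r∈ with ∈P.∈-++⁻ (List.map (_↑ˡ N′ ℕ.* K) (below a K)) r∈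
  ... | inj₁ r∈₁ = ∈-below⁻ r (∈-map-injective⁻ (FinP.↑ˡ-injective _ _ _) r∈₁)
  ... | inj₂ r∈₂ = ⊥-elim (↑ˡ∉map-↑ʳ r r∈₂)
  ∈-copiesOf⁻ {suc N′} (a ∷ e) (suc z) r r∈ with ∈P.∈-++⁻ (List.map (_↑ˡ N′ ℕ.* K) (below a K)) r∈
  ... | inj₁ r∈₁ = ⊥-elim (↑ʳ∉map-↑ˡ (combine z r) r∈₁)
  ... | inj₂ r∈₂ = ∈-copiesOf⁻ e z r (∈-map-injective⁻ (FinP.↑ʳ-injective K _ _) r∈₂)

  copiesOf-unique : ∀ {N′} (e : Exponent N′) → Unique (copiesOf e)
  copiesOf-unique []      = []
  copiesOf-unique (a ∷ e) = UniqueP.++⁺ (UniqueP.map⁺ (FinP.↑ˡ-injective _ _ _) (below-unique a K))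
    (UniqueP.map⁺ (FinP.↑ʳ-injective K _ _) (copiesOf-unique e)) disjoint
    where
    disjoint : ∀ {v} → v ∈ List.map (_↑ˡ _) (below a K) × v ∈ List.map (K ↑ʳ_) (copiesOf e) → ⊥
    disjoint (v∈₁ , v∈₂) with ∈P.∈-map⁻ _ v∈₁
    ... | r , _ , ≡.refl = ↑ˡ∉map-↑ʳ r v∈₂

  prod-copiesOf : ∀ {N′} (e : Exponent N′) (f : Fin (N′ ℕ.* K) → Pol N) (σ : Fin N′ → Pol N) →
    (∀ z r → f (combine z r) ≈ₚ σ z) → (∀ z → lookup e z ≤ K) →
    prodP F (List.map f (copiesOf e)) ≈ₚ monoSubstₚ e σ
  prod-copiesOf []      f σ f≈σ e≤K = ≈ₚ-refl
  prod-copiesOf (a ∷ e) f σ f≈σ e≤K = begin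
    prodP F (List.map f (List.map (_↑ˡ _) (below a K) ++ List.map (K ↑ʳ_) (copiesOf e)))
      ≈⟨ ≈ₚ-reflexive (≡.cong (prodP F) (ListP.map-++ f (List.map (_↑ˡ _) (below a K)) (List.map (K ↑ʳ_) (copiesOf e)))) ⟩
    prodP F (List.map f (List.map (_↑ˡ _) (below a K)) ++ List.map f (List.map (K ↑ʳ_) (copiesOf e)))
      ≈⟨ prodP-++ (List.map f (List.map (_↑ˡ _) (below a K))) _ ⟩
    prodP F (List.map f (List.map (_↑ˡ _) (below a K))) *ₚ prodP F (List.map f (List.map (K ↑ʳ_) (copiesOf e)))
      ≈⟨ *ₚ-cong (≈ₚ-trans (copies-of-x₀ (below a K)) (≈ₚ-reflexive (≡.cong (σ zero ^ₚ_) (length-below (e≤K zero)))))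
                 (≈ₚ-trans (≈ₚ-reflexive (≡.cong (prodP F) (≡.sym (ListP.map-∘ (copiesOf e)))))
                           (prod-copiesOf e (f ∘ (K ↑ʳ_)) (σ ∘ suc) (f≈σ ∘ suc) (e≤K ∘ suc))) ⟩
    σ zero ^ₚ a *ₚ monoSubstₚ e (σ ∘ suc) ∎
    where
    open ≈ₚ-Reasoning
    copies-of-x₀ : ∀ rs → prodP F (List.map f (List.map (_↑ˡ _) rs)) ≈ₚ σ zero ^ₚ length rs
    copies-of-x₀ []       = ≈ₚ-refl
    copies-of-x₀ (r ∷ rs) = *ₚ-cong (f≈σ zero r) (copies-of-x₀ rs)

  -- The circuit has a layer of N·K input gates (K copies of each variable, since a gate may
  -- not use the same child twice), a constant gate q(e) and a product gate q(e)·x^e for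
  -- every monomial e of degree ≤ K, and the output gate summing the products.
  module _ (q : Exponent N → Carrier) where
    NK : ℕ
    NK = N ℕ.* K

    n₁ n₂ n₃ : ℕ
    n₁ = NK ℕ.+ 0
    n₂ = M ℕ.+ n₁
    n₃ = M ℕ.+ n₂

    variableOf : Fin NK → Fin N
    variableOf b = proj₁ (remQuot K b)

    inputGate : Fin NK → GateDef F N 0
    inputGate b = inVar (variableOf b)

    inputs : Circ F N n₁
    inputs = addLayer [] inputGate

    constantGate : Fin M → GateDef F N n₁
    constantGate i = inConst (q (E i))

    constants : Circ F N n₂
    constants = addLayer inputs constantGate

    constant : Fin M → Fin n₂
    constant i = i ↑ˡ n₁

    copy : Fin NK → Fin n₂
    copy b = M ↑ʳ (b ↑ˡ 0)

    product : Fin M → Fin n₃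
    product i = i ↑ˡ n₂

    productGate : Fin M → GateDef F N n₂
    productGate i = op times (constant i ∷ List.map copy (copiesOf (E i)))

    products : Circ F N n₃
    products = addLayer constants productGate

    outputGate : Fin 1 → GateDef F N n₃
    outputGate _ = op plus (List.map product (List.allFin M))

    circuit : Circ F N (suc n₃)
    circuit = addLayer products outputGate

    value-copy : ∀ b → gateValue F constants (copy b) ≡ varₚ (variableOf b)
    value-copy b = ≡.trans (value-↑ʳ inputs constantGate (b ↑ˡ 0)) (value-↑ˡ [] inputGate b)

    value-product : ∀ i → gateValue F products (product i) ≈ₚ constₚ (q (E i)) *ₚ monomialₚ (E i)
    value-product i = begin
      gateValue F products (product i)
        ≡⟨ value-↑ˡ constants productGate i ⟩
      gateValue F constants (constant i) *ₚ prodP F (List.map (gateValue F constants) (List.map copy (copiesOf (E i))))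
        ≡⟨ ≡.cong₂ _*ₚ_ (value-↑ˡ inputs constantGate i) (≡.cong (prodP F) (≡.sym (ListP.map-∘ (copiesOf (E i))))) ⟩
      constₚ (q (E i)) *ₚ prodP F (List.map (gateValue F constants ∘ copy) (copiesOf (E i)))
        ≈⟨ *ₚ-congˡ (constₚ (q (E i))) (prod-copiesOf (E i) _ varₚ copy-of-x (λ z → ℕP.≤-trans (lookup≤sum (E i) z) (sum-E≤K i))) ⟩
      constₚ (q (E i)) *ₚ monoSubstₚ (E i) varₚ
        ≈⟨ *ₚ-congˡ (constₚ (q (E i))) (monoSubst-varₚ (E i)) ⟩
      constₚ (q (E i)) *ₚ monomialₚ (E i) ∎
      where
      open ≈ₚ-Reasoning
      copy-of-x : ∀ z r → gateValue F constants (copy (combine z r)) ≈ₚ varₚ z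
      copy-of-x z r = ≈ₚ-reflexive (≡.trans (value-copy (combine z r)) (≡.cong (varₚ ∘ proj₁) (FinP.remQuot-combine z r)))
      lookup≤sum : ∀ {n} (e : Exponent n) z → lookup e z ≤ Vec.sum e
      lookup≤sum (x ∷ e) zero    = ℕP.m≤m+n x (Vec.sum e)
      lookup≤sum (x ∷ e) (suc z) = ℕP.≤-trans (lookup≤sum e z) (ℕP.m≤n+m (Vec.sum e) x)

    output≈∑ : output F circuit ≈ₚ ∑ₚ (λ i → constₚ (q (E i)) *ₚ monomialₚ (E i))
    output≈∑ = begin
      output F circuit
        ≡⟨ value-↑ˡ products outputGate zero ⟩
      sumP F (List.map (gateValue F products) (List.map product (List.allFin M)))
        ≡⟨ ≡.cong (sumP F) (≡.sym (ListP.map-∘ (List.allFin M))) ⟩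
      sumP F (List.map (gateValue F products ∘ product) (List.allFin M))
        ≡⟨ sumP-allFin (gateValue F products ∘ product) ⟩
      ∑ₚ (gateValue F products ∘ product)
        ≈⟨ ∑ₚ-cong value-product ⟩
      ∑ₚ (λ i → constₚ (q (E i)) *ₚ monomialₚ (E i)) ∎
      where open ≈ₚ-Reasoning

    coeff-output : ∀ e → coeffₚ (output F circuit) e ≈ ∑ᶠ.sum (λ i → q (E i) * δ e (E i))
    coeff-output e = trans (coeff-≈ output≈∑ e) (trans (coeff-∑ₚ (λ i → constₚ (q (E i)) *ₚ monomialₚ (E i)) e)
      (∑ᶠ.sum-cong-≋ (λ i → trans (coeff-const* (q (E i)) (monomialₚ (E i)) e) (*-congˡ (coeff-monomial (E i) e)))))

    computes : ∀ (P : Pol N) → (∀ e → Vec.sum e ≤ K → q e ≈ coeffₚ P e) → DegreeAtMost F K P → output F circuit ≈ₚ P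
    computes P q≈P deg≤K = mk≈ λ e → trans (coeff-output e) (by-degree e (Vec.sum e ℕP.≤? K))
      where
      by-degree : ∀ e → Dec (Vec.sum e ≤ K) → ∑ᶠ.sum (λ i → q (E i) * δ e (E i)) ≈ coeffₚ P e
      by-degree e (yes e≤K) = begin
        ∑ᶠ.sum (λ i → q (E i) * δ e (E i)) ≈⟨ ∑ᶠ-single _ (indexOf e e≤K) (λ j j≢ → trans (*-congˡ (δ-≢ {e = e} {d = E j} (j≢ ∘ E-injective ∘ E≡))) (zeroʳ _)) ⟩
        q (E i) * δ e (E i)                ≈⟨ *-congˡ (trans (reflexive (≡.cong (δ e) (E-indexOf e e≤K))) (δ-refl e)) ⟩
        q (E i) * 1#                       ≈⟨ *-identityʳ _ ⟩
        q (E i)                            ≡⟨ ≡.cong q (E-indexOf e e≤K) ⟩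
        q e                                ≈⟨ q≈P e e≤K ⟩
        coeffₚ P e                         ∎
        where
        open import Relation.Binary.Reasoning.Setoid setoid
        i = indexOf e e≤K
        E≡ : ∀ {j} → E j ≡ e → E j ≡ E i
        E≡ Ej≡e = ≡.trans Ej≡e (≡.sym (E-indexOf e e≤K))
      by-degree e (no e≰K) = trans (∑ᶠ-zero (λ j → trans (*-congˡ (δ-≢ {e = e} {d = E j} (λ Ej≡e → e≰K (≡.subst (λ v → Vec.sum v ≤ K) Ej≡e (sum-E≤K j))))) (zeroʳ _)))
                                   (sym (deg≤K e (ℕP.≰⇒> e≰K)))

    copy-used : ∀ b → Σ (Fin M) λ i → b ∈ copiesOf (E i)
    copy-used b = ≡.subst (λ b′ → Σ (Fin M) λ i → b′ ∈ copiesOf (E i)) (FinP.combine-remQuot {N} K b) (used z r)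
      where
      z = proj₁ (remQuot {N} K b)
      r = proj₂ (remQuot {N} K b)
      used : ∀ z r → Σ (Fin M) λ i → combine z r ∈ copiesOf (E i)
      used z r = i , ≡.subst (λ e → combine z r ∈ copiesOf e) (≡.sym (E-indexOf e e≤K))
                               (∈-copiesOf⁺ e z r (≡.subst (toℕ r <_) (≡.sym (lookup-power-≡ z (suc (toℕ r)))) ℕP.≤-refl))
        where
        e = power z (suc (toℕ r))
        e≤K : Vec.sum e ≤ K
        e≤K = ≡.subst (_≤ K) (≡.sym (sum-power z (suc (toℕ r)))) (FinP.toℕ<n r)
        i = indexOf e e≤K

    copy-injective : ∀ {b b′} → copy b ≡ copy b′ → b ≡ b′
    copy-injective eq = FinP.↑ˡ-injective 0 _ _ (FinP.↑ʳ-injective M _ _ eq)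

    wellFormed : WellFormed F circuit
    wellFormed = opsHaveChildren , childrenUnique , hasParent
      where
      zeros≤K : Vec.sum (zeros {N}) ≤ K
      zeros≤K = ℕP.≤-trans (ℕP.≤-reflexive (sum-zeros N)) z≤n
      opsHaveChildren : OpsHaveChildren circuit
      opsHaveChildren =
        OpsHaveChildren-addLayer products outputGate
          (OpsHaveChildren-addLayer constants productGate
            (OpsHaveChildren-addLayer inputs constantGate
              (OpsHaveChildren-addLayer [] inputGate (λ ()) (λ _ _ ()))
              (λ _ _ ()))
            (λ i _ _ → constant i , here ≡.refl))
          (λ _ _ _ → product (indexOf zeros zeros≤K) , ∈P.∈-map⁺ product (∈P.∈-allFin _))
      constant∉copies : ∀ i {x} → x ∈ List.map copy (copiesOf (E i)) → constant i ≢ x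
      constant∉copies i x∈ ≡.refl = ↑ˡ∉map-↑ʳ i (≡.subst (constant i ∈_) (ListP.map-∘ (copiesOf (E i))) x∈)
      childrenUnique : ChildrenUnique circuit
      childrenUnique =
        ChildrenUnique-addLayer products outputGate
          (ChildrenUnique-addLayer constants productGate
            (ChildrenUnique-addLayer inputs constantGate
              (ChildrenUnique-addLayer [] inputGate (λ ()) (λ _ → []))
              (λ _ → []))
            (λ i → All.tabulate (constant∉copies i) ∷ UniqueP.map⁺ copy-injective (copiesOf-unique (E i))))
          (λ _ → UniqueP.map⁺ (FinP.↑ˡ-injective n₂ _ _) (UniqueP.allFin⁺ M))
      hasParent : ∀ (j : Fin n₃) → HasParent circuit (suc j)
      hasParent = ↑-elim _
        (λ i → HasParent-layer products outputGate (product i) zero (∈P.∈-map⁺ product (∈P.∈-allFin i)))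
        (λ x → HasParent-↑ʳ products outputGate (M ↑ʳ x) (parent-in-products x))
        where
        parent-in-products : ∀ (x : Fin n₂) → HasParent products (M ↑ʳ x)
        parent-in-products = ↑-elim _
          (λ i → HasParent-layer constants productGate (constant i) i (here ≡.refl))
          (↑-elim _ (λ b → let i , b∈ = copy-used b in
                           HasParent-layer constants productGate (copy b) i (there (∈P.∈-map⁺ copy b∈)))
                    (λ ()))

    copyMap : (Fin N → Fin N) → Fin NK → Fin NK
    copyMap t b = combine (t (variableOf b)) (proj₂ (remQuot {N} K b))

    copyMap-combine : ∀ t z r → copyMap t (combine z r) ≡ combine (t z) r
    copyMap-combine t z r = ≡.cong₂ (λ x y → combine (t (proj₁ x)) (proj₂ y)) (FinP.remQuot-combine z r) (FinP.remQuot-combine z r)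

    noGate : Fin 0 → Fin 0
    noGate ()

    onInputs : (Fin N → Fin N) → Fin n₁ → Fin n₁
    onInputs t = blockMap (copyMap t) noGate

    onConstants : (Fin N → Fin N) → (Fin M → Fin M) → Fin n₂ → Fin n₂
    onConstants t ψ = blockMap ψ (onInputs t)

    onProducts : (Fin N → Fin N) → (Fin M → Fin M) → Fin n₃ → Fin n₃
    onProducts t ψ = blockMap ψ (onConstants t ψ)

    automorphism : (Fin N → Fin N) → (Fin M → Fin M) → Fin (suc n₃) → Fin (suc n₃)
    automorphism t ψ = blockMap (id {A = Fin 1}) (onProducts t ψ)

    automorphism-inverse : ∀ {t t′ ψ ψ′} → (∀ z → t (t′ z) ≡ z) → (∀ i → ψ (ψ′ i) ≡ i) →
      ∀ u → automorphism t ψ (automorphism t′ ψ′ u) ≡ u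
    automorphism-inverse {t} {t′} {ψ} {ψ′} tt′ ψψ′ =
      blockMap-inverse (id {A = Fin 1}) id (onProducts t ψ) (onProducts t′ ψ′) (λ _ → ≡.refl)
        (blockMap-inverse ψ ψ′ (onConstants t ψ) (onConstants t′ ψ′) ψψ′
          (blockMap-inverse ψ ψ′ (onInputs t) (onInputs t′) ψψ′
            (blockMap-inverse (copyMap t) (copyMap t′) noGate noGate copyMap-inverse (λ ()))))
      where
      copyMap-inverse : ∀ b → copyMap t (copyMap t′ b) ≡ b
      copyMap-inverse b = begin
        copyMap t (copyMap t′ b)                 ≡⟨ copyMap-combine t (t′ (variableOf b)) _ ⟩
        combine (t (t′ (variableOf b))) _        ≡⟨ ≡.cong (λ z → combine z (proj₂ (remQuot {N} K b))) (tt′ (variableOf b)) ⟩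
        combine (variableOf b) _                 ≡⟨ FinP.combine-remQuot {N} K b ⟩
        b                                        ∎
        where open ≡.≡-Reasoning

    module _ (t : Fin N → Fin N) (ψ : Fin M → Fin M)
             (ψ-spec : ∀ i z → lookup (E (ψ i)) (t z) ≡ lookup (E i) z) where

      ψ-injective : ∀ {i j} → ψ i ≡ ψ j → i ≡ j
      ψ-injective {i} {j} ψi≡ψj = E-injective (Vec-ext λ z → begin
        lookup (E i) z         ≡⟨ ψ-spec i z ⟨
        lookup (E (ψ i)) (t z) ≡⟨ ≡.cong (λ k → lookup (E k) (t z)) ψi≡ψj ⟩
        lookup (E (ψ j)) (t z) ≡⟨ ψ-spec j z ⟩
        lookup (E j) z         ∎)
        where open ≡.≡-Reasoning

      CopyRespected : Fin M → Fin NK → Set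
      CopyRespected i b = (b ∈ copiesOf (E i) → copyMap t b ∈ copiesOf (E (ψ i))) ×
                          (copyMap t b ∈ copiesOf (E (ψ i)) → b ∈ copiesOf (E i))

      copies-respected : ∀ i b → CopyRespected i b
      copies-respected i b =
        ≡.subst (CopyRespected i) (FinP.combine-remQuot {N} K b) (respected (variableOf b) (proj₂ (remQuot {N} K b)))
        where
        respected : ∀ z r → CopyRespected i (combine z r)
        respected z r rewrite copyMap-combine t z r =
            (λ r∈ → ∈-copiesOf⁺ (E (ψ i)) (t z) r (≡.subst (toℕ r <_) (≡.sym (ψ-spec i z)) (∈-copiesOf⁻ (E i) z r r∈)))
          , (λ r∈ → ∈-copiesOf⁺ (E i) z r (≡.subst (toℕ r <_) (ψ-spec i z) (∈-copiesOf⁻ (E (ψ i)) (t z) r r∈)))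

      variableOf-copyMap : ∀ b → variableOf (copyMap t b) ≡ t (variableOf b)
      variableOf-copyMap b = ≡.cong proj₁ (FinP.remQuot-combine (t (variableOf b)) (proj₂ (remQuot {N} K b)))

      onConstants-constant : ∀ i → onConstants t ψ (constant i) ≡ constant (ψ i)
      onConstants-constant i = blockMap-↑ˡ ψ (onInputs t) i

      onConstants-copy : ∀ b → onConstants t ψ (copy b) ≡ copy (copyMap t b)
      onConstants-copy b = ≡.trans (blockMap-↑ʳ ψ (onInputs t) (b ↑ˡ 0)) (≡.cong (M ↑ʳ_) (blockMap-↑ˡ (copyMap t) noGate b))

      constant∈productChildren⁻ : ∀ {i j cs} → constant i ∈ constant j ∷ List.map copy cs → i ≡ j
      constant∈productChildren⁻ (here eq)  = FinP.↑ˡ-injective n₁ _ _ eq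
      constant∈productChildren⁻ {i} {cs = cs} (there i∈) =
        ⊥-elim (↑ˡ∉map-↑ʳ i (≡.subst (constant i ∈_) (ListP.map-∘ cs) i∈))

      copy∈productChildren⁻ : ∀ {b j cs} → copy b ∈ constant j ∷ List.map copy cs → b ∈ cs
      copy∈productChildren⁻ (here eq)  = ⊥-elim (↑ˡ≢↑ʳ _ _ (≡.sym eq))
      copy∈productChildren⁻ (there b∈) = ∈-map-injective⁻ copy-injective b∈

      product-edges : ∀ u j →
        (u ∈ gateChildren (productGate j) → onConstants t ψ u ∈ gateChildren (productGate (ψ j))) ×
        (onConstants t ψ u ∈ gateChildren (productGate (ψ j)) → u ∈ gateChildren (productGate j))
      product-edges = ↑-elim _ constant-edges (↑-elim _ copy-edges (λ ()))
        where
        constant-edges : ∀ i j →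
          (constant i ∈ gateChildren (productGate j) → onConstants t ψ (constant i) ∈ gateChildren (productGate (ψ j))) ×
          (onConstants t ψ (constant i) ∈ gateChildren (productGate (ψ j)) → constant i ∈ gateChildren (productGate j))
        constant-edges i j rewrite onConstants-constant i =
            (λ i∈ → here (≡.cong (constant ∘ ψ) (constant∈productChildren⁻ i∈)))
          , (λ ψi∈ → here (≡.cong constant (ψ-injective (constant∈productChildren⁻ ψi∈))))
        copy-edges : ∀ b j →
          (copy b ∈ gateChildren (productGate j) → onConstants t ψ (copy b) ∈ gateChildren (productGate (ψ j))) ×
          (onConstants t ψ (copy b) ∈ gateChildren (productGate (ψ j)) → copy b ∈ gateChildren (productGate j))
        copy-edges b j rewrite onConstants-copy b =
            (λ b∈ → there (∈P.∈-map⁺ copy (proj₁ (copies-respected j b) (copy∈productChildren⁻ b∈))))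
          , (λ tb∈ → there (∈P.∈-map⁺ copy (proj₂ (copies-respected j b) (copy∈productChildren⁻ tb∈))))

      output-edges : ∀ u (j : Fin 1) →
        (u ∈ gateChildren (outputGate j) → onProducts t ψ u ∈ gateChildren (outputGate j)) ×
        (onProducts t ψ u ∈ gateChildren (outputGate j) → u ∈ gateChildren (outputGate j))
      output-edges = ↑-elim _
        (λ i j → (λ _ → ≡.subst (_∈ _) (≡.sym (blockMap-↑ˡ ψ (onConstants t ψ) i)) (∈P.∈-map⁺ product (∈P.∈-allFin (ψ i))))
               , (λ _ → ∈P.∈-map⁺ product (∈P.∈-allFin i)))
        (λ x j → (λ x∈ → ⊥-elim (↑ʳ∉map-↑ˡ x x∈))
               , (λ tx∈ → ⊥-elim (↑ʳ∉map-↑ˡ (onConstants t ψ x) (≡.subst (_∈ _) (blockMap-↑ʳ ψ (onConstants t ψ) x) tx∈))))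

      automorphism-preservesEdges : PreservesEdges circuit (automorphism t ψ)
      automorphism-preservesEdges =
        PreservesEdges-addLayer products outputGate
          (PreservesEdges-addLayer constants productGate
            (PreservesEdges-addLayer inputs constantGate
              (PreservesEdges-addLayer [] inputGate (λ ()) (λ ()))
              (λ _ _ → (λ ()) , (λ ())))
            product-edges)
          output-edges

      automorphism-labels : ∀ {r} (R : Label F N → Label F N → Set r) →
        (∀ z → R (lvar z) (lvar (t z))) → (∀ o → R (lop o) (lop o)) →
        (∀ i → R (lconst (q (E i))) (lconst (q (E (ψ i))))) →
        ∀ u → R (label F circuit u) (label F circuit (automorphism t ψ u))
      automorphism-labels R R-var R-op R-const =
        labels-addLayer products outputGate R
          (labels-addLayer constants productGate R
            (labels-addLayer inputs constantGate R
              (labels-addLayer [] inputGate R (λ ())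
                (λ b → ≡.subst (λ z → R (lvar (variableOf b)) (lvar z)) (≡.sym (variableOf-copyMap b)) (R-var (variableOf b))))
              R-const)
            (λ _ → R-op times))
          (λ _ → R-op plus)

module GroupAction {a ℓ g gℓ : Level} (F : Field a ℓ) (Γ : Group g gℓ) {nX : ℕ} (A : Action Γ nX)
  {m : ℕ} (fs : Fin m → Poly F nX) (invariant : Invariant F A fs) (distinct : Distinct F A fs) where
  open Field F hiding (zero)
  open Polynomials F
  open Renaming F
  open FinSum
  open Group Γ using (_∙_; ε; _⁻¹) renaming (Carrier to G; _≈_ to _≈ᴳ_)
  module Γ = Group Γ
  open Action A

  actₚ : G → Pol nX → Pol nX
  actₚ = actPoly F A

  actₚ-∙ : ∀ π τ f → actₚ (π ∙ τ) f ≈ₚ actₚ π (actₚ τ f)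
  actₚ-∙ π τ f = ≈ₚ-sym (≈ₚ-trans (subst-subst f _ _) (subst-congʳ f λ x →
    ≈ₚ-trans (subst-var (act τ x) _) (≈ₚ-reflexive (≡.cong varₚ (≡.sym (act-comp π τ x))))))

  actₚ-ε : ∀ f → actₚ ε f ≈ₚ f
  actₚ-ε f = ≈ₚ-trans (subst-≗ʳ f (≡.cong varₚ ∘ act-id)) (subst-var-id f)

  actₚ-cong : ∀ {π τ} → π ≈ᴳ τ → ∀ f → actₚ π f ≈ₚ actₚ τ f
  actₚ-cong π≈τ f = subst-≗ʳ f (≡.cong varₚ ∘ act-cong π≈τ)

  actY : G → Fin m → Fin m
  actY π i = proj₁ (invariant π i)

  actY-spec : ∀ π i → actₚ π (fs i) ≈ₚ fs (actY π i)
  actY-spec π i = mk≈ (proj₂ (invariant π i))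

  actY-unique : ∀ {π i j} → actₚ π (fs i) ≈ₚ fs j → actY π i ≡ j
  actY-unique {π} {i} πfᵢ≈fⱼ = distinct _ _ (coeff-≈ (≈ₚ-trans (≈ₚ-sym (actY-spec π i)) πfᵢ≈fⱼ))

  actY-∙ : ∀ π τ i → actY (π ∙ τ) i ≡ actY π (actY τ i)
  actY-∙ π τ i = actY-unique (≈ₚ-trans (actₚ-∙ π τ (fs i))
    (≈ₚ-trans (subst-cong _ (actY-spec τ i)) (actY-spec π (actY τ i))))

  actY-ε : ∀ i → actY ε i ≡ i
  actY-ε i = actY-unique (actₚ-ε (fs i))

  actY-cong : ∀ {π τ} → π ≈ᴳ τ → ∀ i → actY π i ≡ actY τ i
  actY-cong {π} {τ} π≈τ i = actY-unique (≈ₚ-trans (actₚ-cong π≈τ (fs i)) (actY-spec τ i))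

  actY-inverseʳ : ∀ π i → actY π (actY (π ⁻¹) i) ≡ i
  actY-inverseʳ π i = ≡.trans (≡.sym (actY-∙ π (π ⁻¹) i)) (≡.trans (actY-cong (Γ.inverseʳ π) i) (actY-ε i))

  actY-inverseˡ : ∀ π i → actY (π ⁻¹) (actY π i) ≡ i
  actY-inverseˡ π i = ≡.trans (≡.sym (actY-∙ (π ⁻¹) π i)) (≡.trans (actY-cong (Γ.inverseˡ π) i) (actY-ε i))

  actY-permutation : G → Permutation′ m
  actY-permutation π = Perm.permutation (actY π) (actY (π ⁻¹)) (actY-inverseʳ π) (actY-inverseˡ π)

  N : ℕ
  N = nX ℕ.+ m

  actZ : G → Fin N → Fin N
  actZ π z = [ (λ x → act π x ↑ˡ m) , (λ i → nX ↑ʳ actY π i) ]′ (splitAt nX z)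

  actZ-x : ∀ π x → actZ π (x ↑ˡ m) ≡ act π x ↑ˡ m
  actZ-x π x rewrite FinP.splitAt-↑ˡ nX x m = ≡.refl

  actZ-y : ∀ π i → actZ π (nX ↑ʳ i) ≡ nX ↑ʳ actY π i
  actZ-y π i rewrite FinP.splitAt-↑ʳ nX m i = ≡.refl

  actZ-∙ : ∀ π τ z → actZ (π ∙ τ) z ≡ actZ π (actZ τ z)
  actZ-∙ π τ = ↑-elim _
    (λ x → ≡.trans (actZ-x (π ∙ τ) x) (≡.trans (≡.cong (_↑ˡ m) (act-comp π τ x))
             (≡.sym (≡.trans (≡.cong (actZ π) (actZ-x τ x)) (actZ-x π (act τ x))))))
    (λ i → ≡.trans (actZ-y (π ∙ τ) i) (≡.trans (≡.cong (nX ↑ʳ_) (actY-∙ π τ i))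
             (≡.sym (≡.trans (≡.cong (actZ π) (actZ-y τ i)) (actZ-y π (actY τ i))))))

  actZ-ε : ∀ z → actZ ε z ≡ z
  actZ-ε = ↑-elim _ (λ x → ≡.trans (actZ-x ε x) (≡.cong (_↑ˡ m) (act-id x)))
                    (λ i → ≡.trans (actZ-y ε i) (≡.cong (nX ↑ʳ_) (actY-ε i)))

  actZ-cong : ∀ {π τ} → π ≈ᴳ τ → ∀ z → actZ π z ≡ actZ τ z
  actZ-cong {π} {τ} π≈τ = ↑-elim _
    (λ x → ≡.trans (actZ-x π x) (≡.trans (≡.cong (_↑ˡ m) (act-cong π≈τ x)) (≡.sym (actZ-x τ x))))
    (λ i → ≡.trans (actZ-y π i) (≡.trans (≡.cong (nX ↑ʳ_) (actY-cong π≈τ i)) (≡.sym (actZ-y τ i))))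

  actZ-inverseʳ : ∀ π z → actZ π (actZ (π ⁻¹) z) ≡ z
  actZ-inverseʳ π z = ≡.trans (≡.sym (actZ-∙ π (π ⁻¹) z)) (≡.trans (actZ-cong (Γ.inverseʳ π) z) (actZ-ε z))

  actZ-inverseˡ : ∀ π z → actZ (π ⁻¹) (actZ π z) ≡ z
  actZ-inverseˡ π z = ≡.trans (≡.sym (actZ-∙ (π ⁻¹) π z)) (≡.trans (actZ-cong (Γ.inverseˡ π) z) (actZ-ε z))

  actZ-permutation : G → Permutation′ N
  actZ-permutation π = Perm.permutation (actZ π) (actZ (π ⁻¹)) (actZ-inverseʳ π) (actZ-inverseˡ π)

  renameZ : G → Pol N → Pol N
  renameZ π P = substₚ P (varₚ ∘ actZ π)

  -- atZero and atSystem substitute evalZ (λ _ → 0ₚ) and evalZ fs.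
  evalZ : (Fin m → Pol nX) → Fin N → Pol nX
  evalZ τ z = [ varₚ , τ ]′ (splitAt nX z)

  evalZ-x : ∀ τ x → evalZ τ (x ↑ˡ m) ≡ varₚ x
  evalZ-x τ x rewrite FinP.splitAt-↑ˡ nX x m = ≡.refl

  evalZ-y : ∀ τ i → evalZ τ (nX ↑ʳ i) ≡ τ i
  evalZ-y τ i rewrite FinP.splitAt-↑ʳ nX m i = ≡.refl

  evalZ-renameZ : ∀ π (τ : Fin m → Pol nX) → (∀ i → τ (actY π i) ≈ₚ actₚ π (τ i)) →
    ∀ P → substₚ (renameZ π P) (evalZ τ) ≈ₚ actₚ π (substₚ P (evalZ τ))
  evalZ-renameZ π τ τ-equivariant P =
    ≈ₚ-trans (subst-subst P _ (evalZ τ)) (≈ₚ-trans (subst-congʳ P pointwise) (≈ₚ-sym (subst-subst P (evalZ τ) _)))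
    where
    pointwise : ∀ z → substₚ (varₚ (actZ π z)) (evalZ τ) ≈ₚ substₚ (evalZ τ z) (varₚ ∘ act π)
    pointwise = ↑-elim _
      (λ x → ≈ₚ-trans (subst-var _ (evalZ τ)) (≈ₚ-trans (≈ₚ-reflexive (≡.trans (≡.cong (evalZ τ) (actZ-x π x)) (evalZ-x τ (act π x))))
               (≈ₚ-sym (≈ₚ-trans (≈ₚ-reflexive (≡.cong (λ p → substₚ p (varₚ ∘ act π)) (evalZ-x τ x))) (subst-var x _)))))
      (λ i → ≈ₚ-trans (subst-var _ (evalZ τ)) (≈ₚ-trans (≈ₚ-reflexive (≡.trans (≡.cong (evalZ τ) (actZ-y π i)) (evalZ-y τ (actY π i))))
               (≈ₚ-trans (τ-equivariant i) (≈ₚ-reflexive (≡.cong (λ p → substₚ p (varₚ ∘ act π)) (≡.sym (evalZ-y τ i)))))))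

module SizeBound where
  open import Data.Nat using (_+_; _*_; _^_; _≤_)
  open ℕP.≤-Reasoning

  sizeConstant : ℕ → ℕ
  sizeConstant k = suc (2 * 2 ^ k + k)

  *-^ : ∀ a b n → (a * b) ^ n ≡ a ^ n * b ^ n
  *-^ a b zero    = ≡.refl
  *-^ a b (suc n) = ≡.trans (≡.cong (a * b *_) (*-^ a b n)) (interchange a b (a ^ n) (b ^ n))
    where open import Algebra.Properties.CommutativeSemigroup ℕP.*-commutativeSemigroup using (interchange)

  -- Uses (N+1)^K ≤ 2^K N^K and N ≤ N^K.
  gates≤ : ∀ {N M} K → 1 ≤ N → 1 ≤ K → M ≤ suc N ^ K → suc (M + (M + (N * K + 0))) ≤ sizeConstant K * N ^ K
  gates≤ {N} {M} K 1≤N 1≤K M≤ = begin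
    suc (M + (M + (N * K + 0)))       ≤⟨ ℕP.+-mono-≤ 1≤X (ℕP.+-mono-≤ M≤TX (ℕP.+-mono-≤ M≤TX (ℕP.+-monoˡ-≤ 0 NK≤KX))) ⟩
    X + (T * X + (T * X + (K * X + 0))) ≡⟨ solve 3 (λ x t k → x :+ (t :* x :+ (t :* x :+ (k :* x :+ con 0))) := (con 1 :+ (con 2 :* t :+ k)) :* x) ≡.refl X T K ⟩
    sizeConstant K * X                ∎
    where
    open import Data.Nat.Solver using (module +-*-Solver)
    open +-*-Solver
    instance
      N≢0 : ℕ.NonZero N
      N≢0 = ℕ.>-nonZero 1≤N
    X = N ^ K
    T = 2 ^ K
    1≤X : 1 ≤ X
    1≤X = ℕP.m^n>0 N K
    N≤X : N ≤ X
    N≤X = ℕP.≤-trans (ℕP.≤-reflexive (≡.sym (ℕP.^-identityʳ N))) (ℕP.^-monoʳ-≤ N 1≤K)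
    M≤TX : M ≤ T * X
    M≤TX = ℕP.≤-trans M≤ (ℕP.≤-trans (ℕP.^-monoˡ-≤ K (ℕP.≤-trans (s≤s (ℕP.m≤m+n N 0)) (ℕP.+-monoˡ-≤ (N + 0) 1≤N)))
                                      (ℕP.≤-reflexive (*-^ 2 N K)))
    NK≤KX : N * K ≤ K * X
    NK≤KX = ℕP.≤-trans (ℕP.≤-reflexive (ℕP.*-comm N K)) (ℕP.*-monoʳ-≤ K N≤X)

  vars≤ : ∀ {N} K → 1 ≤ N → 1 ≤ K → N ≤ sizeConstant K * N ^ K
  vars≤ {N} K 1≤N 1≤K = ℕP.≤-trans (ℕP.≤-trans (ℕP.≤-reflexive (≡.sym (ℕP.^-identityʳ N))) (ℕP.^-monoʳ-≤ N 1≤K))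
                                   (ℕP.m≤n*m (N ^ K) (sizeConstant K))
    where
    instance
      N≢0 : ℕ.NonZero N
      N≢0 = ℕ.>-nonZero 1≤N

module FiniteGroup {g gℓ : Level} (Γ : Group g gℓ) {n : ℕ} (finite : IsFiniteOfOrder Γ n) where
  open Group Γ

  enum : Fin n → Carrier
  enum = proj₁ finite

  indexOf : Carrier → Fin n
  indexOf x = proj₁ (proj₁ (proj₂ finite) x)

  enum-indexOf : ∀ x → enum (indexOf x) ≈ x
  enum-indexOf x = proj₂ (proj₁ (proj₂ finite) x)

  enum-injective : ∀ i j → enum i ≈ enum j → i ≡ j
  enum-injective = proj₂ (proj₂ finite)

  translation : Carrier → Permutation′ n
  translation h = Perm.permutation (λ i → indexOf (h ∙ enum i)) (λ i → indexOf (h ⁻¹ ∙ enum i))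
    (λ i → enum-injective _ _ (cancel (inverseʳ h) i)) (λ i → enum-injective _ _ (cancel (inverseˡ h) i))
    where
    cancel : ∀ {x y} → x ∙ y ≈ ε → ∀ i → enum (indexOf (x ∙ enum (indexOf (y ∙ enum i)))) ≈ enum i
    cancel {x} {y} xy≈ε i = begin
      enum (indexOf (x ∙ enum (indexOf (y ∙ enum i)))) ≈⟨ enum-indexOf _ ⟩
      x ∙ enum (indexOf (y ∙ enum i))                   ≈⟨ ∙-congˡ (enum-indexOf _) ⟩
      x ∙ (y ∙ enum i)                                  ≈⟨ assoc x y (enum i) ⟨
      (x ∙ y) ∙ enum i                                  ≈⟨ ∙-congʳ xy≈ε ⟩
      ε ∙ enum i                                        ≈⟨ identityˡ (enum i) ⟩
      enum i                                            ∎
      where open import Relation.Binary.Reasoning.Setoid setoid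

  ∑-translate : ∀ {c ℓ′} (M : CommutativeMonoid c ℓ′) (f : Carrier → CommutativeMonoid.Carrier M) →
    (∀ {x y} → x ≈ y → CommutativeMonoid._≈_ M (f x) (f y)) → ∀ h →
    let open Algebra.Properties.CommutativeMonoid.Sum M in
    CommutativeMonoid._≈_ M (sum (f ∘ enum)) (sum (λ i → f (h ∙ enum i)))
  ∑-translate M f f-cong h = ≈ᴹ-trans (sum-permute (f ∘ enum) (translation h)) (sum-cong-≋ (λ i → f-cong (enum-indexOf (h ∙ enum i))))
    where
    open CommutativeMonoid M using () renaming (trans to ≈ᴹ-trans)
    open Algebra.Properties.CommutativeMonoid.Sum M

module Symmetrization {a ℓ g gℓ : Level} (F : Field a ℓ) (Γ : Group g gℓ) {o : ℕ}
  (finite : IsFiniteOfOrder Γ (suc o)) (|Γ|⁻¹ : Field.Carrier F)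
  (|Γ|⁻¹-inverse : Field._≈_ F (Field._*_ F (_×1 F (suc o)) |Γ|⁻¹) (Field.1# F))
  {nX : ℕ} (A : Action Γ nX) {m : ℕ} (fs : Fin m → Poly F nX)
  (invariant : Invariant F A fs) (distinct : Distinct F A fs) where

  open Field F hiding (zero)
  open Polynomials F
  open Renaming F
  open GroupAction F Γ A fs invariant distinct
  open FiniteGroup Γ finite
  open Group Γ using (_∙_; _⁻¹) renaming (Carrier to G; _≈_ to _≈ᴳ_)

  average : ∀ {k} → (Fin (suc o) → Pol k) → Pol k
  average X = constₚ |Γ|⁻¹ *ₚ ∑ₚ X

  coeff-average : ∀ {k} (X : Fin (suc o) → Pol k) e → coeffₚ (average X) e ≈ |Γ|⁻¹ * ∑ᶠ.sum (λ i → coeffₚ (X i) e)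
  coeff-average X e = trans (coeff-const* |Γ|⁻¹ (∑ₚ X) e) (*-congˡ (coeff-∑ₚ X e))

  average-const : ∀ {k} {X : Fin (suc o) → Pol k} {c} → (∀ i → X i ≈ₚ c) → average X ≈ₚ c
  average-const {X = X} {c} X≈c = mk≈ λ e → begin
    coeffₚ (average X) e                           ≈⟨ coeff-average X e ⟩
    |Γ|⁻¹ * ∑ᶠ.sum (λ i → coeffₚ (X i) e)          ≈⟨ *-congˡ (trans (∑ᶠ.sum-cong-≋ (λ i → coeff-≈ (X≈c i) e)) (∑ᶠ-const (suc o) _)) ⟩
    |Γ|⁻¹ * (_×1 F (suc o) * coeffₚ c e)           ≈⟨ *-assoc _ _ _ ⟨
    (|Γ|⁻¹ * _×1 F (suc o)) * coeffₚ c e           ≈⟨ *-congʳ (trans (*-comm _ _) |Γ|⁻¹-inverse) ⟩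
    1# * coeffₚ c e                                ≈⟨ *-identityˡ _ ⟩
    coeffₚ c e                                     ∎
    where open import Relation.Binary.Reasoning.Setoid setoid

  subst-average : ∀ {k j} (X : Fin (suc o) → Pol k) (σ : Fin k → Pol j) →
    substₚ (average X) σ ≈ₚ average (λ i → substₚ (X i) σ)
  subst-average X σ = ≈ₚ-trans (subst-*ₚ (constₚ |Γ|⁻¹) (∑ₚ X) σ) (*ₚ-cong (subst-const |Γ|⁻¹ σ) (subst-∑ₚ X σ))

  symmetrize : Pol N → Pol N
  symmetrize P = average (λ i → renameZ (enum i) P)

  evalZ-symmetrize : ∀ (τ : Fin m → Pol nX) → (∀ π i → τ (actY π i) ≈ₚ actₚ π (τ i)) →
    ∀ {c} → (∀ π → actₚ π c ≈ₚ c) → ∀ P → substₚ P (evalZ τ) ≈ₚ c → substₚ (symmetrize P) (evalZ τ) ≈ₚ c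
  evalZ-symmetrize τ τ-equivariant c-invariant P P≈c = ≈ₚ-trans (subst-average (λ i → renameZ (enum i) P) (evalZ τ)) (average-const λ i →
    ≈ₚ-trans (evalZ-renameZ (enum i) τ (τ-equivariant (enum i)) P)
             (≈ₚ-trans (subst-cong _ P≈c) (c-invariant (enum i))))

  symmetrize-certificate : ∀ {P} → IsIPSCertificate F fs P → IsIPSCertificate F fs (symmetrize P)
  symmetrize-certificate {P} (at0≈0 , atf≈1) =
      coeff-≈ (evalZ-symmetrize (λ _ → 0ₚ) (λ _ _ → ≈ₚ-refl) {c = 0ₚ} (λ _ → ≈ₚ-refl) P (mk≈ at0≈0))
    , coeff-≈ (evalZ-symmetrize fs (λ π i → ≈ₚ-sym (actY-spec π i)) {c = 1ₚ} (λ π → subst-const 1# (varₚ ∘ Action.act A π)) P (mk≈ atf≈1))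

  coeff-symmetrize : ∀ P e → coeffₚ (symmetrize P) e ≈ |Γ|⁻¹ * ∑ᶠ.sum (λ i → coeffₚ P (reindex (actZ (enum i)) e))
  coeff-symmetrize P e = trans (coeff-average (λ i → renameZ (enum i) P) e) (*-congˡ (∑ᶠ.sum-cong-≋ λ i → coeff-rename (actZ-permutation (enum i)) P e))

  coeff-symmetrize-invariant : ∀ P π e → coeffₚ (symmetrize P) (reindex (actZ π) e) ≈ coeffₚ (symmetrize P) e
  coeff-symmetrize-invariant P π e = begin
    coeffₚ (symmetrize P) (reindex (actZ π) e)
      ≈⟨ coeff-symmetrize P _ ⟩
    |Γ|⁻¹ * ∑ᶠ.sum (λ i → coeffₚ P (reindex (actZ (enum i)) (reindex (actZ π) e)))
      ≡⟨ ≡.cong (|Γ|⁻¹ *_) (∑ᶠ.sum-cong-≗ λ i → ≡.cong (coeffₚ P) (≡.trans (reindex-∘ (actZ (enum i)) (actZ π) e)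
           (VecP-tabulate-cong (λ z → ≡.cong (lookup e) (≡.sym (actZ-∙ π (enum i) z)))))) ⟩
    |Γ|⁻¹ * ∑ᶠ.sum (λ i → coeffₚ P (reindex (actZ (π ∙ enum i)) e))
      ≈⟨ *-congˡ (∑-translate +-commutativeMonoid (λ x → coeffₚ P (reindex (actZ x) e)) coeff-cong π) ⟨
    |Γ|⁻¹ * ∑ᶠ.sum (λ i → coeffₚ P (reindex (actZ (enum i)) e))
      ≈⟨ coeff-symmetrize P e ⟨
    coeffₚ (symmetrize P) e ∎
    where
    open import Relation.Binary.Reasoning.Setoid setoid
    VecP-tabulate-cong = VecP.tabulate-cong
    coeff-cong : ∀ {x y} → x ≈ᴳ y → coeffₚ P (reindex (actZ x) e) ≈ coeffₚ P (reindex (actZ y) e)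
    coeff-cong x≈y = reflexive (≡.cong (coeffₚ P) (VecP-tabulate-cong (λ z → ≡.cong (lookup e) (actZ-cong x≈y z))))

  symmetrize-degree : ∀ {K P} → DegreeAtMost F K P → DegreeAtMost F K (symmetrize P)
  symmetrize-degree {K} {P} P-deg e K<e = trans (coeff-symmetrize P e) (trans (*-congˡ (∑ᶠ-zero λ i →
    P-deg (reindex (actZ (enum i)) e) (≡.subst (K ℕ.<_) (≡.sym (sum-reindex (actZ-permutation (enum i)) e)) K<e))) (zeroʳ _))

  yTerm : (Fin m → Pol nX) → Fin m → Pol N
  yTerm gs i = yvar F fs i *ₚ substₚ (gs i) (xvar F fs)

  linearInY : (Fin m → Pol nX) → Pol N
  linearInY gs = ∑ₚ (yTerm gs)

  symmetrizeY : (Fin m → Pol nX) → Fin m → Pol nX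
  symmetrizeY gs i = average (λ k → actₚ (enum k) (gs (actY (enum k ⁻¹) i)))

  renameZ-y*x : ∀ π i h → renameZ π (yvar F fs i *ₚ substₚ h (xvar F fs)) ≈ₚ
                         yvar F fs (actY π i) *ₚ substₚ (actₚ π h) (xvar F fs)
  renameZ-y*x π i h = ≈ₚ-trans (subst-*ₚ (yvar F fs i) (substₚ h (xvar F fs)) (varₚ ∘ actZ π))
    (*ₚ-cong y-renamed x-renamed)
    where
    open ≈ₚ-Reasoning
    y-renamed : renameZ π (yvar F fs i) ≈ₚ yvar F fs (actY π i)
    y-renamed = ≈ₚ-trans (subst-var (nX ↑ʳ i) (varₚ ∘ actZ π)) (≈ₚ-reflexive (≡.cong varₚ (actZ-y π i)))
    x-renamed : renameZ π (substₚ h (xvar F fs)) ≈ₚ substₚ (actₚ π h) (xvar F fs)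
    x-renamed = begin
      substₚ (substₚ h (xvar F fs)) (varₚ ∘ actZ π)            ≈⟨ subst-subst h (xvar F fs) (varₚ ∘ actZ π) ⟩
      substₚ h (λ x → substₚ (xvar F fs x) (varₚ ∘ actZ π))    ≈⟨ subst-congʳ h (λ x → subst-var (x ↑ˡ m) (varₚ ∘ actZ π)) ⟩
      substₚ h (λ x → varₚ (actZ π (x ↑ˡ m)))                  ≈⟨ subst-≗ʳ h (λ x → ≡.cong varₚ (actZ-x π x)) ⟩
      substₚ h (xvar F fs ∘ Action.act A π)                    ≈⟨ subst-congʳ h (λ x → subst-var (Action.act A π x) (xvar F fs)) ⟨
      substₚ h (λ x → substₚ (varₚ (Action.act A π x)) (xvar F fs)) ≈⟨ subst-subst h (varₚ ∘ Action.act A π) (xvar F fs) ⟨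
      substₚ (actₚ π h) (xvar F fs)                            ∎

  renameZ-linearInY : ∀ π gs → renameZ π (linearInY gs) ≈ₚ linearInY (λ i → actₚ π (gs (actY (π ⁻¹) i)))
  renameZ-linearInY π gs = begin
    renameZ π (linearInY gs)
      ≈⟨ subst-∑ₚ (λ i → yvar F fs i *ₚ substₚ (gs i) (xvar F fs)) (varₚ ∘ actZ π) ⟩
    ∑ₚ (λ i → renameZ π (yvar F fs i *ₚ substₚ (gs i) (xvar F fs)))
      ≈⟨ ∑ₚ-cong (λ i → ≈ₚ-trans (renameZ-y*x π i (gs i))
           (*ₚ-congˡ (yvar F fs (actY π i)) (subst-cong (xvar F fs) (≈ₚ-reflexive (≡.cong (actₚ π ∘ gs) (≡.sym (actY-inverseˡ π i))))))) ⟩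
    ∑ₚ (summand ∘ actY π)
      ≈⟨ ∑ₚ.sum-permute summand (actY-permutation π) ⟨
    ∑ₚ summand ∎
    where
    open ≈ₚ-Reasoning
    summand : Fin m → Pol N
    summand j = yvar F fs j *ₚ substₚ (actₚ π (gs (actY (π ⁻¹) j))) (xvar F fs)

  average-linearInY : ∀ (H : Fin (suc o) → Fin m → Pol nX) →
    average (λ k → linearInY (H k)) ≈ₚ linearInY (λ i → average (λ k → H k i))
  average-linearInY H = begin
    constₚ |Γ|⁻¹ *ₚ ∑ₚ (λ k → ∑ₚ (λ i → y i *ₚ x (H k i)))
      ≈⟨ *ₚ-congˡ (constₚ |Γ|⁻¹) (∑ₚ.∑-comm (λ k i → y i *ₚ x (H k i))) ⟩
    constₚ |Γ|⁻¹ *ₚ ∑ₚ (λ i → ∑ₚ (λ k → y i *ₚ x (H k i)))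
      ≈⟨ *ₚ-congˡ (constₚ |Γ|⁻¹) (∑ₚ-cong (λ i → ∑ₚ.*-distribˡ-sum (y i) (λ k → x (H k i)))) ⟨
    constₚ |Γ|⁻¹ *ₚ ∑ₚ (λ i → y i *ₚ ∑ₚ (λ k → x (H k i)))
      ≈⟨ ∑ₚ.*-distribˡ-sum (constₚ |Γ|⁻¹) (λ i → y i *ₚ ∑ₚ (λ k → x (H k i))) ⟩
    ∑ₚ (λ i → constₚ |Γ|⁻¹ *ₚ (y i *ₚ ∑ₚ (λ k → x (H k i))))
      ≈⟨ ∑ₚ-cong (λ i → x∙yz≈y∙xz (constₚ |Γ|⁻¹) (y i) (∑ₚ (λ k → x (H k i)))) ⟩
    ∑ₚ (λ i → y i *ₚ average (λ k → x (H k i)))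
      ≈⟨ ∑ₚ-cong (λ i → *ₚ-congˡ (y i) (subst-average (λ k → H k i) (xvar F fs))) ⟨
    ∑ₚ (λ i → y i *ₚ x (average (λ k → H k i))) ∎
    where
    open ≈ₚ-Reasoning
    open import Algebra.Properties.CommutativeSemigroup
      (CommutativeSemiring.*-commutativeSemigroup (Pol-commutativeSemiring N)) using (x∙yz≈y∙xz)
    y = yvar F fs
    x = λ h → substₚ h (xvar F fs)

  symmetrize-linearInY : ∀ {P} gs → P ≈ₚ linearInY gs → symmetrize P ≈ₚ linearInY (symmetrizeY gs)
  symmetrize-linearInY {P} gs P≈ = ≈ₚ-trans
    (*ₚ-congˡ (constₚ |Γ|⁻¹) (∑ₚ-cong (λ k → ≈ₚ-trans (subst-cong _ P≈) (renameZ-linearInY (enum k) gs))))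
    (average-linearInY (λ k i → actₚ (enum k) (gs (actY (enum k ⁻¹) i))))

  IsYLinear-symmetrize : ∀ {s s′} (C : Circ F N (suc s)) (C′ : Circ F N (suc s′)) →
    output F C′ ≈ₚ symmetrize (output F C) → IsYLinear F fs C → IsYLinear F fs C′
  IsYLinear-symmetrize C C′ C′≈ (gs , C≈) = symmetrizeY gs , coeff-≈ (≈ₚ-trans C′≈ (≈ₚ-trans
    (symmetrize-linearInY {output F C} gs (≈ₚ-trans (mk≈ C≈) (≈ₚ-reflexive (sumP-allFin (yTerm gs)))))
    (≈ₚ-reflexive (≡.sym (sumP-allFin (yTerm (symmetrizeY gs)))))))

  module SymmetricCircuit (K : ℕ) (P : Pol N) where
    open MonomialCircuit F N K
    open Monomials

    Csym : Circ F N (suc (n₃ (coeffₚ (symmetrize P))))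
    Csym = circuit (coeffₚ (symmetrize P))

    Csym-computes : DegreeAtMost F K P → output F Csym ≈ₚ symmetrize P
    Csym-computes P-deg = computes _ (symmetrize P) (λ _ _ → refl) (symmetrize-degree {P = P} P-deg)

    monomialAction : G → Fin M → Fin M
    monomialAction π i = MonomialCircuit.indexOf F N K (reindex (actZ (π ⁻¹)) (E i))
      (≡.subst (_≤ K) (≡.sym (sum-reindex (actZ-permutation (π ⁻¹)) (E i))) (sum-E≤K i))

    E-monomialAction : ∀ π i → E (monomialAction π i) ≡ reindex (actZ (π ⁻¹)) (E i)
    E-monomialAction π i = E-indexOf _ _

    monomialAction-spec : ∀ π i z → lookup (E (monomialAction π i)) (actZ π z) ≡ lookup (E i) z
    monomialAction-spec π i z = begin
      lookup (E (monomialAction π i)) (actZ π z)            ≡⟨ ≡.cong (λ e → lookup e (actZ π z)) (E-monomialAction π i) ⟩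
      lookup (reindex (actZ (π ⁻¹)) (E i)) (actZ π z)       ≡⟨ lookup-reindex (actZ (π ⁻¹)) (E i) (actZ π z) ⟩
      lookup (E i) (actZ (π ⁻¹) (actZ π z))                 ≡⟨ ≡.cong (lookup (E i)) (actZ-inverseˡ π z) ⟩
      lookup (E i) z                                        ∎
      where open ≡.≡-Reasoning

    monomialAction-inverse : ∀ π π′ → (∀ z → actZ (π′ ⁻¹) (actZ (π ⁻¹) z) ≡ z) →
      ∀ i → monomialAction π (monomialAction π′ i) ≡ i
    monomialAction-inverse π π′ inverse i = E-injective (begin
      E (monomialAction π (monomialAction π′ i))                 ≡⟨ E-monomialAction π _ ⟩
      reindex (actZ (π ⁻¹)) (E (monomialAction π′ i))           ≡⟨ ≡.cong (reindex (actZ (π ⁻¹))) (E-monomialAction π′ i) ⟩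
      reindex (actZ (π ⁻¹)) (reindex (actZ (π′ ⁻¹)) (E i))      ≡⟨ reindex-∘ _ _ (E i) ⟩
      reindex (actZ (π′ ⁻¹) ∘ actZ (π ⁻¹)) (E i)                ≡⟨ reindex-id inverse (E i) ⟩
      E i                                                       ∎)
      where open ≡.≡-Reasoning

    variable-labels : ∀ π z → LabelRel F A fs π (lvar z) (lvar (actZ π z))
    variable-labels π = ↑-elim _ x-label y-label
      where
      open FinSum
      x-label : ∀ x → LabelRel F A fs π (lvar (x ↑ˡ m)) (lvar (actZ π (x ↑ˡ m)))
      x-label x rewrite FinP.splitAt-↑ˡ nX x m = lift ≡.refl
      y-label : ∀ i → LabelRel F A fs π (lvar (nX ↑ʳ i)) (lvar (actZ π (nX ↑ʳ i)))
      y-label i rewrite FinP.splitAt-↑ʳ nX m i = actY π i , proj₂ (invariant π i) , ≡.refl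

    constant-labels : ∀ π i → LabelRel F A fs π (lconst (coeffₚ (symmetrize P) (E i)))
                                                (lconst (coeffₚ (symmetrize P) (E (monomialAction π i))))
    constant-labels π i = _ , ≡.refl , sym (trans (reflexive (≡.cong (coeffₚ (symmetrize P)) (E-monomialAction π i)))
                                                (coeff-symmetrize-invariant P (π ⁻¹) (E i)))

    Csym-size : 1 ≤ N → 1 ≤ K → refutationSize F nX m Csym ≤ SizeBound.sizeConstant K ℕ.* systemSize F nX m ℕ.^ K
    Csym-size 1≤N 1≤K = ≡.subst (λ n → refutationSize F nX m Csym ≤ SizeBound.sizeConstant K ℕ.* n ℕ.^ K) (ℕP.+-comm nX m)
      (ℕP.⊔-lub (SizeBound.gates≤ K 1≤N 1≤K (length-monomials N K)) (SizeBound.vars≤ K 1≤N 1≤K))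

    Csym-symmetric : IsSymmetric F A fs Csym
    Csym-symmetric π = automorphism q (actZ π) (monomialAction π)
      , ( ( automorphism q (actZ (π ⁻¹)) (monomialAction (π ⁻¹))
          , automorphism-inverse q {actZ π} {actZ (π ⁻¹)} (actZ-inverseʳ π) (monomialAction-inverse π (π ⁻¹) (actZ-inverseˡ (π ⁻¹)))
          , automorphism-inverse q {actZ (π ⁻¹)} {actZ π} (actZ-inverseˡ π) (monomialAction-inverse (π ⁻¹) π (actZ-inverseʳ (π ⁻¹))))
        , automorphism-preservesEdges q (actZ π) (monomialAction π) (monomialAction-spec π)
        , automorphism-labels q (actZ π) (monomialAction π) (monomialAction-spec π) (LabelRel F A fs π)
            (variable-labels π) (λ _ → lift ≡.refl) (constant-labels π))
      where q = coeffₚ (symmetrize P)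

module Certificates {a ℓ : Level} (F : Field a ℓ) where
  open Polynomials F

  -- A certificate is 0 at y = 0 and 1 at y = f, so it cannot be blind to y.
  certificate-separates : ∀ {nX m} (fs : Fin m → Poly F nX) {P} → IsIPSCertificate F fs P →
    ¬ (atZero F fs P ≈ₚ atSystem F fs P)
  certificate-separates fs (at0≈0 , atf≈1) at0≈atf = 0ₚ≉1ₚ (≈ₚ-trans (≈ₚ-sym (mk≈ at0≈0)) (≈ₚ-trans at0≈atf (mk≈ atf≈1)))

  no-degree0-certificate : ∀ {nX m} (fs : Fin m → Poly F nX) {P} → IsIPSCertificate F fs P → ¬ DegreeAtMost F 0 P
  no-degree0-certificate fs {P} cert deg≤0 = certificate-separates fs {P} cert
    (≈ₚ-trans (constant-at _) (≈ₚ-sym (constant-at _)))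
    where
    constant-at : ∀ σ → substₚ P σ ≈ₚ constₚ (coeffₚ P zeros)
    constant-at σ = ≈ₚ-trans (subst-cong σ (degree0⇒const P deg≤0)) (subst-const _ σ)

  no-certificate-without-equations : ∀ {nX} (fs : Fin 0 → Poly F nX) {P} → ¬ IsIPSCertificate F fs P
  no-certificate-without-equations {nX} fs {P} cert = certificate-separates fs {P} cert (subst-≗ʳ P same-values)
    where
    same-values : ∀ z → [ varₚ , (λ _ → 0ₚ) ]′ (splitAt nX z) ≡ [ varₚ , fs ]′ (splitAt nX z)
    same-values z with splitAt nX z
    ... | inj₁ x = ≡.refl
    ... | inj₂ ()

  certificate-cong : ∀ {nX m} (fs : Fin m → Poly F nX) {P Q} → P ≈ₚ Q → IsIPSCertificate F fs P → IsIPSCertificate F fs Q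
  certificate-cong fs P≈Q (at0≈0 , atf≈1) =
      coeff-≈ (≈ₚ-trans (≈ₚ-sym (subst-cong _ P≈Q)) (mk≈ {q = 0ₚ} at0≈0))
    , coeff-≈ (≈ₚ-trans (≈ₚ-sym (subst-cong _ P≈Q)) (mk≈ {q = 1ₚ} atf≈1))

open import Data.Nat using (ℕ; suc; _+_; _*_; _^_; _≤_)

SymmetricRefutationOf : ∀ {a ℓ g gℓ} {F : Field a ℓ} {Γ : Group g gℓ} {nX m} → Action Γ nX →
  (fs : Fin m → Poly F nX) → (c k : ℕ) → ∀ {s} → Circ F (nX + m) (suc s) → Set (a ⊔ ℓ ⊔ g)
SymmetricRefutationOf {F = F} {nX = nX} {m} A fs c k C =
  Σ ℕ λ s′ → Σ (Circ F (nX + m) (suc s′)) λ Csym →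
    IsIPSRefutation F fs Csym ×
    IsSymmetric F A fs Csym ×
    refutationSize F nX m Csym ≤ c * systemSize F nX m ^ k ×
    c * systemSize F nX m ^ k ≤ c * refutationSize F nX m C ^ k ×
    (IsYLinear F fs C → IsYLinear F fs Csym)

open SizeBound using (sizeConstant)

systemSize≤refutationSize : ∀ {a ℓ} {F : Field a ℓ} nX m {s} (C : Circ F (nX + m) (suc s)) →
  systemSize F nX m ≤ refutationSize F nX m C
systemSize≤refutationSize nX m {s} C = ℕP.≤-trans (ℕP.≤-reflexive (ℕP.+-comm m nX)) (ℕP.m≤n⊔m (suc s) (nX + m))

symmetrization : ∀ {a ℓ g gℓ : Level} (k : ℕ) (F : Field a ℓ) (Γ : Group g gℓ) (o : ℕ) →
  IsFiniteOfOrder Γ o → CharCondition F o →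
  ∀ (nX : ℕ) (A : Action Γ nX) (m : ℕ) (fs : Fin m → Poly F nX) → Invariant F A fs → Distinct F A fs →
  ∀ {s : ℕ} (C : Circ F (nX + m) (suc s)) → IsIPSRefutation F fs C → SemanticDegreeAtMost F k C →
  SymmetricRefutationOf A fs (sizeConstant k) k C
symmetrization ℕ.zero F Γ o finite cc nX A m fs inv dist C (_ , cert) deg =
  ⊥-elim (Certificates.no-degree0-certificate F fs {output F C} cert (deg zero))
symmetrization (suc K′) F Γ ℕ.zero (_ , onto , _) cc nX A m fs inv dist C ref deg =
  ⊥-elim (FinP.¬Fin0 (proj₁ (onto (Group.ε Γ))))
symmetrization (suc K′) F Γ (suc o) finite cc nX A ℕ.zero fs inv dist C (_ , cert) deg =
  ⊥-elim (Certificates.no-certificate-without-equations F fs {output F C} cert)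
symmetrization (suc K′) F Γ (suc o) finite cc nX A (suc m) fs invariant distinct C (_ , cert) deg =
  _ , Csym , (wellFormed (coeffₚ (symmetrize (output F C))) , certificate) , Csym-symmetric ,
  Csym-size (ℕP.≤-trans (s≤s z≤n) (ℕP.m≤n+m (suc m) nX)) (s≤s z≤n) ,
  ℕP.*-monoʳ-≤ (sizeConstant (suc K′)) (ℕP.^-monoˡ-≤ (suc K′) (systemSize≤refutationSize nX (suc m) C)) ,
  IsYLinear-symmetrize C Csym computes
  where
  open Polynomials F
  open Characteristic F using (·1-invertible)
  open Symmetrization F Γ finite (proj₁ (·1-invertible o cc)) (proj₂ (·1-invertible o cc)) A fs invariant distinct
  open SymmetricCircuit (suc K′) (output F C)
  open MonomialCircuit F (nX + suc m) (suc K′) using (wellFormed)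
  computes = Csym-computes (deg zero)
  certificate = Certificates.certificate-cong F fs (≈ₚ-sym computes) (symmetrize-certificate {output F C} cert)

theorem4p4 : ∀ {a ℓ g gℓ : Level} (k : ℕ) →
  Σ ℕ λ c →
  ∀ (F : Field a ℓ) (Γ : Group g gℓ) (o : ℕ) →
  IsFiniteOfOrder Γ o →
  CharCondition F o →
  ∀ (nX : ℕ) (A : Action Γ nX) (m : ℕ) (fs : Fin m → Poly F nX) →
  Invariant F A fs →
  Distinct F A fs →
  ∀ {s : ℕ} (C : Circ F (nX + m) (suc s)) →
  IsIPSRefutation F fs C →
  SemanticDegreeAtMost F k C →
  Σ ℕ λ s′ → Σ (Circ F (nX + m) (suc s′)) λ Csym →
    IsIPSRefutation F fs Csym ×
    IsSymmetric F A fs Csym ×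
    refutationSize F nX m Csym ≤ c * systemSize F nX m ^ k ×
    c * systemSize F nX m ^ k ≤ c * refutationSize F nX m C ^ k ×
    (IsYLinear F fs C → IsYLinear F fs Csym)
theorem4p4 k = sizeConstant k , symmetrization k
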